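{- Let $M$ be a binary matroid on ground set $V$, let $Z$ be a basis of $M$, and let $G$ be a graph with $\mathcal{M}_G=M*Z$. Let $P=\{v\in V\mid \exists X\in\mathcal{CS}_M,\ v\in X,\ X\setminus\{v\}\in\mathcal{CS}_M^\perp\}$, $Q=\{v\in V\mid\exists X\in\mathcal{CS}_M^\perp,\ v\in X,\ X\setminus\{v\}\in\mathcal{CS}_M\}$, $R=\{v\in V\mid \exists X\in\mathcal{CS}_M\cap\mathcal{CS}_M^\perp,\ v\in X\}$. For $v\in V\setminus Z$: (1) $v\in P$ iff $\mathrm{nmax}_{G+V}(v)=\nu(G+V+v)$; (2) $v\in Q$ iff $\mathrm{nmax}_{G+V}(v)=\nu(G+V\setminus v)$; (3) $v\in R$ iff $\mathrm{nmax}_{G+V}(v)=\nu(G+V)$. For $v\in Z$, the same statements hold with the roles of $P$ and $Q$ interchanged.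
   Context: Graphs on $V$ (loops allowed) are identified with their adjacency matrices (symmetric $V\times V$ over $\mathrm{GF}(2)$, diagonal entry $1$ iff loop). $\nu(H)$ is the nullity over $\mathrm{GF}(2)$ of the adjacency matrix of $H$. For $X\subseteq V$, $H+X$ complements the loop status of the vertices in $X$; $H\setminus v$ deletes vertex $v$; operations are applied left to right, so $G+V+v=G+(V\setminus\{v\})$ and $G+V\setminus v=(G+V)\setminus v$. For a graph $H$, $\mathrm{nmax}_H(v)=\max\{\nu(H),\nu(H\setminus v),\nu(H+v)\}$. $\mathcal{M}_G=(V,\{X\subseteq V: A(G)[X]\text{ nonsingular}\})$ ($A(G)[\emptyset]$ nonsingular by convention). $M$ is identified with the set system of its bases and $M*Z=(V,\{X\triangle Z: X\text{ basis}\})$. $\mathcal{CS}_M$ is the cycle space (span over $\mathrm{GF}(2)$ of incidence vectors of circuits), $\mathcal{CS}_M^\perp$ its orthogonal complement; vectors are identified with supports. -}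

module Defs where

open import Data.Nat using (ℕ; zero; suc; pred; _∸_; _⊔_)
open import Data.Bool using (Bool; true; false; _∧_; _∨_; not; _xor_; if_then_else_; T)
open import Data.Fin using (Fin; zero; suc; punchIn; _≟_)
open import Data.Fin.Subset using (Subset; ⊥; ⊤; ⁅_⁆; _∈_; _∉_; _⊆_; _⊂_; _-_; ∣_∣; _∪_)
open import Data.Vec using (Vec; []; _∷_; lookup; zipWith)
open import Data.List using (List; []; _∷_; map; _++_; foldr)
open import Data.List.Relation.Unary.All using (All)
open import Data.Product using (Σ; ∃; ∃-syntax; _×_; _,_)
open import Relation.Nullary using (¬_; does)
open import Relation.Binary.PropositionalEquality using (_≡_)
open import Function.Bundles using (_⇔_)

-- Linear algebra over GF(2) (Bool: false = 0, true = 1, xor = +, ∧ = ·)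

Matrix : ℕ → ℕ → Set
Matrix m n = Fin m → Fin n → Bool

Σ₂ : ∀ {n} → (Fin n → Bool) → Bool
Σ₂ {zero}  f = false
Σ₂ {suc n} f = f zero xor Σ₂ (λ j → f (suc j))

allFin : ∀ {n} → (Fin n → Bool) → Bool
allFin {zero}  f = true
allFin {suc n} f = f zero ∧ allFin (λ j → f (suc j))

allList : {A : Set} → (A → Bool) → List A → Bool
allList p []       = true
allList p (x ∷ xs) = p x ∧ allList p xs

_·_ : ∀ {m n} → Matrix m n → Subset n → Fin m → Bool
(A · y) i = Σ₂ (λ j → A i j ∧ lookup y j)

_△_ : ∀ {n} → Subset n → Subset n → Subset n
_△_ = zipWith _xor_

_•_ : ∀ {n} → Subset n → Subset n → Bool
X • Y = Σ₂ (λ j → lookup X j ∧ lookup Y j)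

isEmpty? : ∀ {n} → Subset n → Bool
isEmpty? Y = allFin (λ j → not (lookup Y j))

_⊆?_ : ∀ {n} → Subset n → Subset n → Bool
Y ⊆? X = allFin (λ j → not (lookup Y j) ∨ lookup X j)

subsets : ∀ n → List (Subset n)
subsets zero    = [] ∷ []
subsets (suc n) = map (false ∷_) (subsets n) ++ map (true ∷_) (subsets n)

colIndep? : ∀ {m n} → Matrix m n → Subset n → Bool
colIndep? {n = n} A X =
  allList (λ Y → not (Y ⊆? X ∧ allFin (λ i → not ((A · Y) i))) ∨ isEmpty? Y) (subsets n)

rank : ∀ {m n} → Matrix m n → ℕ
rank {n = n} A = foldr _⊔_ 0 (map (λ X → if colIndep? A X then ∣ X ∣ else 0) (subsets n))

ν : ∀ {n} → Matrix n n → ℕ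
ν {n} A = n ∸ rank A

-- Graphs (loops allowed) as symmetric GF(2) adjacency matrices

Graph : ℕ → Set
Graph n = Matrix n n

Symmetric : ∀ {n} → Graph n → Set
Symmetric G = ∀ i j → G i j ≡ G j i

-- H + X : complement the loop status of the vertices in X
_+ₗ_ : ∀ {n} → Graph n → Subset n → Graph n
(H +ₗ X) i j = H i j xor (does (i ≟ j) ∧ lookup X i)

-- H \ v : delete the vertex v (remaining vertices relabelled by punchIn v)
_∖ᵥ_ : ∀ {n} → Graph n → Fin n → Graph (pred n)
_∖ᵥ_ {suc n} H v i j = H (punchIn v i) (punchIn v j)

nmax : ∀ {n} → Graph n → Fin n → ℕ
nmax H v = ν H ⊔ ν (H ∖ᵥ v) ⊔ ν (H +ₗ ⁅ v ⁆)

-- A[X] (principal submatrix) is nonsingular over GF(2): the only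
-- Y ⊆ X with (A y)_i = 0 for all i ∈ X is Y = ∅.  (True for X = ∅.)
principalNonsingular? : ∀ {n} → Matrix n n → Subset n → Bool
principalNonsingular? A X = colIndep? (λ i j → lookup X i ∧ A i j) X

-- Set systems / matroids, given by their bases

SetSystem : ℕ → Set₁
SetSystem n = Subset n → Set

graphMatroid : ∀ {n} → Graph n → SetSystem n
graphMatroid G X = T (principalNonsingular? G X)

_*_ : ∀ {n} → SetSystem n → Subset n → SetSystem n
(M * Z) X = ∃[ Y ] (M Y × X ≡ Y △ Z)

ColBasis : ∀ {m n} → Matrix m n → Subset n → Set
ColBasis A X = T (colIndep? A X) × (∀ j → j ∉ X → ¬ T (colIndep? A (X ∪ ⁅ j ⁆)))

IsBinaryMatroid : ∀ {n} → SetSystem n → Set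
IsBinaryMatroid {n} M = ∃[ r ] Σ (Matrix r n) (λ A → ∀ X → M X ⇔ ColBasis A X)

Independent : ∀ {n} → SetSystem n → Subset n → Set
Independent M X = ∃[ Y ] (M Y × X ⊆ Y)

Circuit : ∀ {n} → SetSystem n → Subset n → Set
Circuit M C = ¬ Independent M C × (∀ Y → Y ⊂ C → Independent M Y)

CS : ∀ {n} → SetSystem n → Subset n → Set
CS M X = ∃[ cs ] (All (Circuit M) cs × foldr _△_ ⊥ cs ≡ X)

_⊥ˢ : ∀ {n} → (Subset n → Set) → Subset n → Set
(S ⊥ˢ) Y = ∀ X → S X → X • Y ≡ false

inP : ∀ {n} → SetSystem n → Fin n → Set
inP M v = ∃[ X ] (CS M X × v ∈ X × (CS M ⊥ˢ) (X - v))

inQ : ∀ {n} → SetSystem n → Fin n → Set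
inQ M v = ∃[ X ] ((CS M ⊥ˢ) X × v ∈ X × CS M (X - v))

inR : ∀ {n} → SetSystem n → Fin n → Set
inR M v = ∃[ X ] (CS M X × (CS M ⊥ˢ) X × v ∈ X)

-- Represent M over GF(2) by a matrix A, so that Z is a set of independent columns spanning all
-- others, and put H = G + V.  Principal minors of size one and two show that G is the fundamental
-- graph of Z: it is bipartite between Z and V ∖ Z, and z ∈ Z is adjacent to j ∉ Z exactly when z
-- lies in the fundamental circuit of j.  Hence X ∈ CS_M iff (H X)_z = 0 for all z ∈ Z, and
-- X ∈ CS_M^⊥ iff (H X)_j = 0 for all j ∉ Z, and P, Q, R become statements about the symmetric
-- matrix H and the unit vector e_v: R says some kernel vector of H contains v; failing that,
-- H y = e_v is solvable (Fredholm alternative), by a y containing v (P) or avoiding it (Q); for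
-- v ∈ Z the roles of CS_M and CS_M^⊥, hence of P and Q, are swapped.  Finally ∣ker∣ = 2^ν over
-- GF(2), and comparing the kernels of H, H + v and H ∖ v by splitting on x_v and translating by a
-- kernel vector or a solution of H y = e_v shows that in each case one of the three nullities
-- exceeds the other two, which are equal, by one; it is therefore nmax.

module Submission where

open import Defs
open import Data.Bool using (Bool; true; false; _∧_; _∨_; not; _xor_; if_then_else_; T) renaming (_≟_ to _≟ᴮ_)
open import Data.Bool.Properties
  using ( xor-∧-commutativeRing; ¬-not; T-≡; not-involutive; ∧-conicalˡ; ∧-conicalʳ; ∧-zeroʳ; ∧-identityʳ
        ; ∧-comm; ∧-assoc; ∧-distribˡ-xor; ∧-distribʳ-xor; ∨-identityʳ; ∨-zeroʳ; xor-identityʳ; xor-same; xor-comm )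
open import Data.Empty using (⊥-elim)
open import Data.Fin using (Fin; zero; suc; punchIn; _≟_)
open import Data.Fin.Properties using (any?; punchInᵢ≢i; punchIn-punchOut)
open import Data.Fin.Subset using (Subset; ⊥; ⊤; ⁅_⁆; _∪_; _∩_; ∁; _-_; _∈_; _∉_; ∣_∣; _⊆_; _⊂_)
open import Data.Fin.Subset.Properties
  using (x∈⁅x⁆; x∈⁅y⁆⇒x≡y; p─⊥≡p; ∣⊥∣≡0; ∣p∣≤n; p⊆p∪q; q⊆p∪q; p⊂q⇒∣p∣<∣q∣; anySubset?)
open import Data.List using (List; []; _∷_; map; _++_; foldr)
import Data.List as List
open import Data.List.Membership.Propositional using () renaming (_∈_ to _∈ₗ_)
open import Data.List.Membership.Propositional.Properties
  using (∈-++⁺ˡ; ∈-++⁺ʳ; ∈-map⁺; ∈-map⁻; ∈-allFin; foldr-selective)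
open import Data.List.Relation.Unary.All using (All; []; _∷_)
open import Data.List.Relation.Unary.Any using (here; there)
open import Data.Maybe using (just; nothing)
open import Data.Nat using (ℕ; zero; suc; _+_; _∸_; _^_; _≤_; _⊔_)
open import Data.Nat.Logarithm using (⌊log₂_⌋; ⌊log₂[2^n]⌋≡n)
open import Data.Nat.Properties
  using ( +-identityʳ; +-∸-assoc; +-commutativeSemigroup; m≤m⊔n; m≤n⊔m; ⊔-sel; ≤-refl; ≤-trans
        ; ≤-reflexive; <⇒≱; ∸-cancelˡ-≡; 1+n≢n )
open import Algebra.Properties.CommutativeSemigroup +-commutativeSemigroup using (interchange)
open import Data.Product using (∃-syntax; _×_; _,_; proj₁; proj₂)
open import Data.Sum using (_⊎_; inj₁; inj₂)
open import Data.Vec using (Vec; []; _∷_; lookup; tabulate; insertAt)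
open import Data.Vec.Properties
  using ( lookup-zipWith; lookup-map; lookup∘tabulate; tabulate∘lookup; tabulate-cong; []=⇒lookup; lookup⇒[]=
        ; insertAt-lookup; insertAt-punchIn; ≡-dec )
open import Function using (_∘_)
open import Function.Bundles using (_⇔_; mk⇔; Equivalence)
open import Function.Properties.Equivalence using () renaming (trans to ⇔-trans)
open import Relation.Binary.Definitions using (DecidableEquality)
open import Relation.Binary.PropositionalEquality
open import Relation.Nullary using (¬_; Dec; does; yes; no)
open import Relation.Nullary.Decidable using (dec-true; dec-false) renaming (map to Dec-map)
open import Tactic.RingSolver using (solve-∀)
open import Tactic.RingSolver.Core.AlmostCommutativeRing using (AlmostCommutativeRing; fromCommutativeRing)

private
  variable
    m n : ℕ

GF2 : AlmostCommutativeRing _ _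
GF2 = fromCommutativeRing xor-∧-commutativeRing λ { false → just refl ; true → nothing }

xor-interchange : ∀ a b c d → (a xor b) xor (c xor d) ≡ (a xor c) xor (b xor d)
xor-interchange = solve-∀ GF2

xor-left-comm : ∀ a b c → a xor (b xor c) ≡ b xor (a xor c)
xor-left-comm = solve-∀ GF2

xor-cancelʳ : ∀ a b → (a xor b) xor b ≡ a
xor-cancelʳ = solve-∀ GF2

xor-moveʳ : ∀ {p q r} → p ≡ q xor r → q ≡ p xor r
xor-moveʳ {q = q} {r} refl = sym (xor-cancelʳ q r)

∧-left-comm : ∀ a b c → a ∧ (b ∧ c) ≡ b ∧ (a ∧ c)
∧-left-comm = solve-∀ GF2

xor-true : ∀ a → a xor true ≡ not a
xor-true false = refl
xor-true true  = refl

xor≡false⇒≡ : ∀ {a b} → a xor b ≡ false → a ≡ b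
xor≡false⇒≡ {false} {false} _ = refl
xor≡false⇒≡ {true}  {true}  _ = refl

≡⇒xor≡false : ∀ {a b} → a ≡ b → a xor b ≡ false
≡⇒xor≡false {a} refl = xor-same a

true≢false : true ≢ false
true≢false ()

Bool-ext : ∀ {a b} → (a ≡ true ⇔ b ≡ true) → a ≡ b
Bool-ext {false} {false} _   = refl
Bool-ext {false} {true}  a⇔b = Equivalence.from a⇔b refl
Bool-ext {true}  {false} a⇔b = sym (Equivalence.to a⇔b refl)
Bool-ext {true}  {true}  _   = refl

not≡true⇔ : ∀ {a} → not a ≡ true ⇔ a ≡ false
not≡true⇔ {false} = mk⇔ (λ _ → refl) (λ _ → refl)
not≡true⇔ {true}  = mk⇔ (λ ()) (λ ())

not∨≡true⇔ : ∀ {a b} → not a ∨ b ≡ true ⇔ (a ≡ true → b ≡ true)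
not∨≡true⇔ {false} = mk⇔ (λ _ ()) (λ _ → refl)
not∨≡true⇔ {true}  = mk⇔ (λ b _ → b) (λ b → b refl)

∧≡true⇔ : ∀ {a b} → a ∧ b ≡ true ⇔ (a ≡ true × b ≡ true)
∧≡true⇔ {true}  = mk⇔ (λ b → refl , b) proj₂
∧≡true⇔ {false} = mk⇔ (λ ()) (λ ())

infixl 9 _!_
_!_ : ∀ {A : Set} → Vec A n → Fin n → A
_!_ = lookup

≗⇒≡ : ∀ {A : Set} {x y : Vec A n} → (∀ i → x ! i ≡ y ! i) → x ≡ y
≗⇒≡ {x = x} {y} x≗y = trans (sym (tabulate∘lookup x)) (trans (tabulate-cong x≗y) (tabulate∘lookup y))

δ : Fin n → Fin n → Bool
δ i j = does (i ≟ j)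

δ-refl : (i : Fin n) → δ i i ≡ true
δ-refl i = dec-true (i ≟ i) refl

δ-≢ : ∀ {i j : Fin n} → i ≢ j → δ i j ≡ false
δ-≢ {i = i} {j} = dec-false (i ≟ j)

δ-sym : (i j : Fin n) → δ i j ≡ δ j i
δ-sym i j with i ≟ j
... | yes refl = sym (δ-refl i)
... | no i≢j = sym (δ-≢ (i≢j ∘ sym))

Σ₂-cong : {f g : Fin n → Bool} → (∀ i → f i ≡ g i) → Σ₂ f ≡ Σ₂ g
Σ₂-cong {zero}  f≗g = refl
Σ₂-cong {suc n} f≗g = cong₂ _xor_ (f≗g zero) (Σ₂-cong (f≗g ∘ suc))

Σ₂-zero : {f : Fin n → Bool} → (∀ i → f i ≡ false) → Σ₂ f ≡ false
Σ₂-zero {zero}  f≗0 = refl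
Σ₂-zero {suc n} f≗0 rewrite f≗0 zero = Σ₂-zero (f≗0 ∘ suc)

Σ₂-xor : (f g : Fin n → Bool) → Σ₂ (λ i → f i xor g i) ≡ Σ₂ f xor Σ₂ g
Σ₂-xor {zero}  f g = refl
Σ₂-xor {suc n} f g = trans (cong ((f zero xor g zero) xor_) (Σ₂-xor (f ∘ suc) (g ∘ suc)))
                           (xor-interchange (f zero) (g zero) _ _)

Σ₂-∧ˡ : ∀ a (f : Fin n → Bool) → Σ₂ (λ i → a ∧ f i) ≡ a ∧ Σ₂ f
Σ₂-∧ˡ false f = Σ₂-zero {f = λ i → false ∧ f i} λ _ → refl
Σ₂-∧ˡ true  f = refl

Σ₂-swap : (f : Fin m → Fin n → Bool) → Σ₂ (λ i → Σ₂ (f i)) ≡ Σ₂ (λ j → Σ₂ (λ i → f i j))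
Σ₂-swap {zero} {n} f = sym (Σ₂-zero {n} λ _ → refl)
Σ₂-swap {suc m} f = trans (cong (Σ₂ (f zero) xor_) (Σ₂-swap (f ∘ suc)))
                          (sym (Σ₂-xor (f zero) (λ j → Σ₂ (λ i → f (suc i) j))))

Σ₂-δ : (u : Fin n) (f : Fin n → Bool) → Σ₂ (λ j → δ j u ∧ f j) ≡ f u
Σ₂-δ zero    f = trans (cong (f zero xor_) (Σ₂-zero {f = λ j → δ (suc j) zero ∧ f (suc j)} λ _ → refl)) (xor-identityʳ (f zero))
Σ₂-δ (suc u) f = Σ₂-δ u (f ∘ suc)

Σ₂-punchIn : (v : Fin (suc n)) (f : Fin (suc n) → Bool) → Σ₂ f ≡ f v xor Σ₂ (f ∘ punchIn v)
Σ₂-punchIn         zero    f = refl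
Σ₂-punchIn {suc n} (suc v) f = trans (cong (f zero xor_) (Σ₂-punchIn v (f ∘ suc)))
                                     (xor-left-comm (f zero) (f (suc v)) _)

Σ₂-perturbʳ : (i₀ : Fin m) (s : Bool) (f y : Fin m → Bool) →
              Σ₂ (λ k → f k ∧ (y k xor (δ k i₀ ∧ s))) ≡ Σ₂ (λ k → f k ∧ y k) xor (f i₀ ∧ s)
Σ₂-perturbʳ i₀ s f y = begin
  Σ₂ (λ k → f k ∧ (y k xor (δ k i₀ ∧ s)))               ≡⟨ Σ₂-cong (λ k → ∧-distribˡ-xor (f k) (y k) _) ⟩
  Σ₂ (λ k → (f k ∧ y k) xor (f k ∧ (δ k i₀ ∧ s)))       ≡⟨ Σ₂-xor (λ k → f k ∧ y k) _ ⟩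
  Σ₂ (λ k → f k ∧ y k) xor Σ₂ (λ k → f k ∧ (δ k i₀ ∧ s)) ≡⟨ cong (Σ₂ (λ k → f k ∧ y k) xor_) sifted ⟩
  Σ₂ (λ k → f k ∧ y k) xor (f i₀ ∧ s)                   ∎
  where
  open ≡-Reasoning
  sifted : Σ₂ (λ k → f k ∧ (δ k i₀ ∧ s)) ≡ f i₀ ∧ s
  sifted = trans (Σ₂-cong λ k → ∧-left-comm (f k) (δ k i₀) s) (Σ₂-δ i₀ (λ k → f k ∧ s))

Σ₂-perturbˡ : (c : Bool) (f g x : Fin m → Bool) →
              Σ₂ (λ k → (f k xor (g k ∧ c)) ∧ x k) ≡ Σ₂ (λ k → f k ∧ x k) xor (c ∧ Σ₂ (λ k → g k ∧ x k))
Σ₂-perturbˡ c f g x = begin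
  Σ₂ (λ k → (f k xor (g k ∧ c)) ∧ x k)                    ≡⟨ Σ₂-cong (λ k → ∧-distribʳ-xor (x k) (f k) _) ⟩
  Σ₂ (λ k → (f k ∧ x k) xor ((g k ∧ c) ∧ x k))            ≡⟨ Σ₂-xor (λ k → f k ∧ x k) _ ⟩
  Σ₂ (λ k → f k ∧ x k) xor Σ₂ (λ k → (g k ∧ c) ∧ x k)     ≡⟨ cong (Σ₂ (λ k → f k ∧ x k) xor_) factored ⟩
  Σ₂ (λ k → f k ∧ x k) xor (c ∧ Σ₂ (λ k → g k ∧ x k))     ∎
  where
  open ≡-Reasoning
  rearrange : ∀ g c x → (g ∧ c) ∧ x ≡ c ∧ (g ∧ x)
  rearrange = solve-∀ GF2
  factored : Σ₂ (λ k → (g k ∧ c) ∧ x k) ≡ c ∧ Σ₂ (λ k → g k ∧ x k)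
  factored = trans (Σ₂-cong λ k → rearrange (g k) c (x k)) (Σ₂-∧ˡ c (λ k → g k ∧ x k))

!-tabulate : (f : Fin n → Bool) (i : Fin n) → tabulate f ! i ≡ f i
!-tabulate = lookup∘tabulate

!-△ : (x y : Subset n) (i : Fin n) → (x △ y) ! i ≡ x ! i xor y ! i
!-△ x y i = lookup-zipWith _xor_ i x y

!-∪ : (x y : Subset n) (i : Fin n) → (x ∪ y) ! i ≡ x ! i ∨ y ! i
!-∪ x y i = lookup-zipWith _∨_ i x y

!-∩ : (x y : Subset n) (i : Fin n) → (x ∩ y) ! i ≡ x ! i ∧ y ! i
!-∩ x y i = lookup-zipWith _∧_ i x y

!-∁ : (x : Subset n) (i : Fin n) → ∁ x ! i ≡ not (x ! i)
!-∁ x i = lookup-map i not x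

!-∩∁ : (x S : Subset n) (j : Fin n) → (x ∩ ∁ S) ! j ≡ x ! j ∧ not (S ! j)
!-∩∁ x S j = trans (!-∩ x (∁ S) j) (cong (x ! j ∧_) (!-∁ S j))

!-⊥ : (i : Fin n) → ⊥ ! i ≡ false
!-⊥ zero    = refl
!-⊥ (suc i) = !-⊥ i

!-⊤ : (i : Fin n) → ⊤ ! i ≡ true
!-⊤ zero    = refl
!-⊤ (suc i) = !-⊤ i

!-⁅⁆ : (j i : Fin n) → ⁅ j ⁆ ! i ≡ δ i j
!-⁅⁆ j i with i ≟ j
... | yes refl = []=⇒lookup (x∈⁅x⁆ i)
... | no i≢j   = ¬-not (i≢j ∘ x∈⁅y⁆⇒x≡y j ∘ lookup⇒[]= i ⁅ j ⁆)

⁅⁆-≢ : {i j : Fin n} → i ≢ j → ⁅ j ⁆ ! i ≡ false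
⁅⁆-≢ {i = i} {j} i≢j = trans (!-⁅⁆ j i) (δ-≢ i≢j)

⁅⁆-self : (j : Fin n) → ⁅ j ⁆ ! j ≡ true
⁅⁆-self j = trans (!-⁅⁆ j j) (δ-refl j)

∪⁅⁆-≢ : (X : Subset n) {i j : Fin n} → i ≢ j → (X ∪ ⁅ j ⁆) ! i ≡ X ! i
∪⁅⁆-≢ X {i} {j} i≢j = trans (!-∪ X ⁅ j ⁆ i) (trans (cong (X ! i ∨_) (⁅⁆-≢ i≢j)) (∨-identityʳ (X ! i)))

∪⁅⁆-self : (X : Subset n) (j : Fin n) → (X ∪ ⁅ j ⁆) ! j ≡ true
∪⁅⁆-self X j = trans (!-∪ X ⁅ j ⁆ j) (trans (cong (X ! j ∨_) (⁅⁆-self j)) (∨-zeroʳ (X ! j)))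

△⁅⁆-≢ : (X : Subset n) {i j : Fin n} → i ≢ j → (X △ ⁅ j ⁆) ! i ≡ X ! i
△⁅⁆-≢ X {i} {j} i≢j = trans (!-△ X ⁅ j ⁆ i) (trans (cong (X ! i xor_) (⁅⁆-≢ i≢j)) (xor-identityʳ (X ! i)))

△⁅⁆-self : (X : Subset n) (j : Fin n) → (X △ ⁅ j ⁆) ! j ≡ not (X ! j)
△⁅⁆-self X j = trans (!-△ X ⁅ j ⁆ j) (trans (cong (X ! j xor_) (⁅⁆-self j)) (xor-true (X ! j)))

△-cancelʳ : (x y : Subset n) → (x △ y) △ y ≡ x
△-cancelʳ x y = ≗⇒≡ λ i → begin
  (x △ y) △ y ! i           ≡⟨ !-△ (x △ y) y i ⟩
  (x △ y) ! i xor y ! i     ≡⟨ cong (_xor y ! i) (!-△ x y i) ⟩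
  (x ! i xor y ! i) xor y ! i ≡⟨ xor-cancelʳ (x ! i) (y ! i) ⟩
  x ! i                     ∎
  where open ≡-Reasoning

△-identityʳ : (X : Subset n) → X △ ⊥ ≡ X
△-identityʳ X = ≗⇒≡ λ i → trans (!-△ X ⊥ i) (trans (cong (X ! i xor_) (!-⊥ i)) (xor-identityʳ (X ! i)))

∩-∁-split : (S x : Subset n) → x ≡ (x ∩ S) △ (x ∩ ∁ S)
∩-∁-split S x = ≗⇒≡ λ j → sym (trans (!-△ (x ∩ S) (x ∩ ∁ S) j)
                              (trans (cong₂ _xor_ (!-∩ x S j) (trans (!-∩ x (∁ S) j) (cong (x ! j ∧_) (!-∁ S j))))
                                     (split (x ! j) (S ! j))))
  where
  split : ∀ a s → (a ∧ s) xor (a ∧ not s) ≡ a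
  split false s     = refl
  split true  false = refl
  split true  true  = refl

!-minus : (p : Subset n) (x i : Fin n) → (p - x) ! i ≡ (if δ i x then false else p ! i)
!-minus (b ∷ p) zero    zero    = refl
!-minus (b ∷ p) zero    (suc i) = cong (_! i) (p─⊥≡p p)
!-minus (b ∷ p) (suc x) zero    = refl
!-minus (b ∷ p) (suc x) (suc i) = !-minus p x i

-∉ : (p : Subset n) (x : Fin n) → (p - x) ! x ≡ false
-∉ p x = trans (!-minus p x x) (cong (if_then false else p ! x) (δ-refl x))

-≡△⁅⁆ : (p : Subset n) (x : Fin n) → p ! x ≡ true → p - x ≡ p △ ⁅ x ⁆
-≡△⁅⁆ p x px = ≗⇒≡ λ i → begin
  (p - x) ! i                     ≡⟨ !-minus p x i ⟩
  (if δ i x then false else p ! i) ≡⟨ pointwise i ⟨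
  p ! i xor δ i x                 ≡⟨ cong (p ! i xor_) (!-⁅⁆ x i) ⟨
  p ! i xor ⁅ x ⁆ ! i             ≡⟨ !-△ p ⁅ x ⁆ i ⟨
  (p △ ⁅ x ⁆) ! i                 ∎
  where
  open ≡-Reasoning
  pointwise : ∀ i → p ! i xor δ i x ≡ (if δ i x then false else p ! i)
  pointwise i with i ≟ x
  ... | yes refl rewrite px = refl
  ... | no _ = xor-identityʳ (p ! i)

∣△⁅⁆∣-∈ : (X : Subset n) (u : Fin n) → X ! u ≡ true → suc ∣ X △ ⁅ u ⁆ ∣ ≡ ∣ X ∣
∣△⁅⁆∣-∈ (true ∷ X)  zero    _ = cong (suc ∘ ∣_∣) (△-identityʳ X)
∣△⁅⁆∣-∈ (false ∷ X) (suc u) Xu = ∣△⁅⁆∣-∈ X u Xu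
∣△⁅⁆∣-∈ (true ∷ X)  (suc u) Xu = cong suc (∣△⁅⁆∣-∈ X u Xu)

∣△⁅⁆∣-∉ : (X : Subset n) (u : Fin n) → X ! u ≡ false → ∣ X △ ⁅ u ⁆ ∣ ≡ suc ∣ X ∣
∣△⁅⁆∣-∉ (false ∷ X) zero    _ = cong (suc ∘ ∣_∣) (△-identityʳ X)
∣△⁅⁆∣-∉ (false ∷ X) (suc u) Xu = ∣△⁅⁆∣-∉ X u Xu
∣△⁅⁆∣-∉ (true ∷ X)  (suc u) Xu = cong suc (∣△⁅⁆∣-∉ X u Xu)

_⊆ᵇ_ : Subset n → Subset n → Set
Y ⊆ᵇ X = ∀ i → Y ! i ≡ true → X ! i ≡ true

⊆ᵇ-intro : {Y S : Subset n} → (∀ i → S ! i ≡ false → Y ! i ≡ false) → Y ⊆ᵇ S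
⊆ᵇ-intro {Y = Y} {S} off i Yi with S ! i in Si
... | true  = refl
... | false = ⊥-elim (true≢false (trans (sym Yi) (off i Si)))

⊆ᵇ-elim : {Y S : Subset n} → Y ⊆ᵇ S → ∀ i → S ! i ≡ false → Y ! i ≡ false
⊆ᵇ-elim Y⊆S i Si = ¬-not λ Yi → true≢false (trans (sym (Y⊆S i Yi)) Si)

⊆⇒⊆ᵇ : {X Y : Subset n} → X ⊆ Y → X ⊆ᵇ Y
⊆⇒⊆ᵇ {X = X} {Y} X⊆Y i Xi = []=⇒lookup (X⊆Y (lookup⇒[]= i X Xi))

⊆ᵇ⇒⊆ : {X Y : Subset n} → X ⊆ᵇ Y → X ⊆ Y
⊆ᵇ⇒⊆ {X = X} {Y} X⊆Y {i} i∈X = lookup⇒[]= i Y (X⊆Y i ([]=⇒lookup i∈X))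

∉⇒≡false : {X : Subset n} {i : Fin n} → i ∉ X → X ! i ≡ false
∉⇒≡false {X = X} {i} i∉X = ¬-not (i∉X ∘ lookup⇒[]= i X)

≡false⇒∉ : {X : Subset n} {i : Fin n} → X ! i ≡ false → i ∉ X
≡false⇒∉ Xi i∈X = true≢false (trans (sym ([]=⇒lookup i∈X)) Xi)

⊂∪⁅⁆ : {S : Subset n} {j : Fin n} → S ! j ≡ false → S ⊂ S ∪ ⁅ j ⁆
⊂∪⁅⁆ {S = S} {j} Sj = p⊆p∪q ⁅ j ⁆ , j , q⊆p∪q S ⁅ j ⁆ (x∈⁅x⁆ j) , ≡false⇒∉ Sj

·-△ : (A : Matrix m n) (x y : Subset n) (i : Fin m) → (A · (x △ y)) i ≡ (A · x) i xor (A · y) i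
·-△ A x y i = trans (Σ₂-cong λ j → trans (cong (A i j ∧_) (!-△ x y j)) (∧-distribˡ-xor (A i j) (x ! j) (y ! j)))
                    (Σ₂-xor (λ j → A i j ∧ x ! j) (λ j → A i j ∧ y ! j))

·-⁅⁆ : (A : Matrix m n) (j : Fin n) (i : Fin m) → (A · ⁅ j ⁆) i ≡ A i j
·-⁅⁆ A j i = trans (Σ₂-cong λ k → trans (cong (A i k ∧_) (!-⁅⁆ j k)) (∧-comm (A i k) (δ k j))) (Σ₂-δ j (A i))

·-⊥ : (A : Matrix m n) (i : Fin m) → (A · ⊥) i ≡ false
·-⊥ A i = Σ₂-zero λ j → trans (cong (A i j ∧_) (!-⊥ j)) (∧-zeroʳ (A i j))

·-split : (A : Matrix m n) (S x : Subset n) (i : Fin m) → (A · x) i ≡ (A · (x ∩ S)) i xor (A · (x ∩ ∁ S)) i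
·-split A S x i = trans (cong (λ y → (A · y) i) (∩-∁-split S x)) (·-△ A (x ∩ S) (x ∩ ∁ S) i)

combination : ∀ {k} → (Fin k → Bool) → (Fin k → Subset n) → Subset n
combination c V = tabulate λ i → Σ₂ λ j → c j ∧ V j ! i

combination-⊆ : ∀ {k} {S : Subset n} (c : Fin k → Bool) (V : Fin k → Subset n) → (∀ j → V j ⊆ᵇ S) →
                combination c V ⊆ᵇ S
combination-⊆ {S = S} c V V⊆S = ⊆ᵇ-intro {Y = combination c V} {S} λ i Si →
  trans (!-tabulate _ i) (Σ₂-zero λ j → trans (cong (c j ∧_) (⊆ᵇ-elim {Y = V j} {S} (V⊆S j) i Si)) (∧-zeroʳ (c j)))

·-combination : ∀ {k} (A : Matrix m n) (c : Fin k → Bool) (V : Fin k → Subset n) (i : Fin m) →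
                (A · combination c V) i ≡ Σ₂ (λ j → c j ∧ (A · V j) i)
·-combination A c V i = begin
  Σ₂ (λ l → A i l ∧ combination c V ! l)              ≡⟨ Σ₂-cong (λ l → cong (A i l ∧_) (!-tabulate _ l)) ⟩
  Σ₂ (λ l → A i l ∧ Σ₂ (λ j → c j ∧ V j ! l))         ≡⟨ Σ₂-cong (λ l → sym (Σ₂-∧ˡ (A i l) λ j → c j ∧ V j ! l)) ⟩
  Σ₂ (λ l → Σ₂ (λ j → A i l ∧ (c j ∧ V j ! l)))       ≡⟨ Σ₂-swap (λ l j → A i l ∧ (c j ∧ V j ! l)) ⟩
  Σ₂ (λ j → Σ₂ (λ l → A i l ∧ (c j ∧ V j ! l)))       ≡⟨ Σ₂-cong (λ j → Σ₂-cong λ l → ∧-left-comm (A i l) (c j) (V j ! l)) ⟩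
  Σ₂ (λ j → Σ₂ (λ l → c j ∧ (A i l ∧ V j ! l)))       ≡⟨ Σ₂-cong (λ j → Σ₂-∧ˡ (c j) λ l → A i l ∧ V j ! l) ⟩
  Σ₂ (λ j → c j ∧ (A · V j) i)                        ∎
  where open ≡-Reasoning

•-combination : ∀ {k} (c : Fin k → Bool) (V : Fin k → Subset n) (X : Subset n) →
                combination c V • X ≡ Σ₂ (λ j → c j ∧ (V j • X))
•-combination c V X = begin
  Σ₂ (λ i → combination c V ! i ∧ X ! i)               ≡⟨ Σ₂-cong (λ i → trans (cong (_∧ X ! i) (!-tabulate _ i)) (∧-comm _ (X ! i))) ⟩
  Σ₂ (λ i → X ! i ∧ Σ₂ (λ j → c j ∧ V j ! i))          ≡⟨ Σ₂-cong (λ i → sym (Σ₂-∧ˡ (X ! i) λ j → c j ∧ V j ! i)) ⟩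
  Σ₂ (λ i → Σ₂ (λ j → X ! i ∧ (c j ∧ V j ! i)))        ≡⟨ Σ₂-swap (λ i j → X ! i ∧ (c j ∧ V j ! i)) ⟩
  Σ₂ (λ j → Σ₂ (λ i → X ! i ∧ (c j ∧ V j ! i)))        ≡⟨ Σ₂-cong (λ j → Σ₂-cong λ i → rearrange (X ! i) (c j) (V j ! i)) ⟩
  Σ₂ (λ j → Σ₂ (λ i → c j ∧ (V j ! i ∧ X ! i)))        ≡⟨ Σ₂-cong (λ j → Σ₂-∧ˡ (c j) λ i → V j ! i ∧ X ! i) ⟩
  Σ₂ (λ j → c j ∧ (V j • X))                           ∎
  where
  open ≡-Reasoning
  rearrange : ∀ x c v → x ∧ (c ∧ v) ≡ c ∧ (v ∧ x)
  rearrange = solve-∀ GF2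

·-selfAdjoint : (H : Graph n) → Symmetric H → (x y : Subset n) →
                Σ₂ (λ i → x ! i ∧ (H · y) i) ≡ Σ₂ (λ j → y ! j ∧ (H · x) j)
·-selfAdjoint H H-sym x y = begin
  Σ₂ (λ i → x ! i ∧ Σ₂ (λ j → H i j ∧ y ! j))     ≡⟨ Σ₂-cong (λ i → sym (Σ₂-∧ˡ (x ! i) λ j → H i j ∧ y ! j)) ⟩
  Σ₂ (λ i → Σ₂ (λ j → x ! i ∧ (H i j ∧ y ! j)))   ≡⟨ Σ₂-swap (λ i j → x ! i ∧ (H i j ∧ y ! j)) ⟩
  Σ₂ (λ j → Σ₂ (λ i → x ! i ∧ (H i j ∧ y ! j)))   ≡⟨ Σ₂-cong (λ j → Σ₂-cong λ i → cong (λ h → x ! i ∧ (h ∧ y ! j)) (H-sym i j)) ⟩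
  Σ₂ (λ j → Σ₂ (λ i → x ! i ∧ (H j i ∧ y ! j)))   ≡⟨ Σ₂-cong (λ j → Σ₂-cong λ i → rearrange (x ! i) (H j i) (y ! j)) ⟩
  Σ₂ (λ j → Σ₂ (λ i → y ! j ∧ (H j i ∧ x ! i)))   ≡⟨ Σ₂-cong (λ j → Σ₂-∧ˡ (y ! j) λ i → H j i ∧ x ! i) ⟩
  Σ₂ (λ j → y ! j ∧ Σ₂ (λ i → H j i ∧ x ! i))     ∎
  where
  open ≡-Reasoning
  rearrange : ∀ a h b → a ∧ (h ∧ b) ≡ b ∧ (h ∧ a)
  rearrange = solve-∀ GF2

Ker : Matrix m n → Subset n → Set
Ker A x = ∀ i → (A · x) i ≡ false

Ker-△ : (A : Matrix m n) (x y : Subset n) → Ker A y → ∀ i → (A · (x △ y)) i ≡ (A · x) i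
Ker-△ A x y Ay≡0 i = trans (·-△ A x y i) (trans (cong ((A · x) i xor_) (Ay≡0 i)) (xor-identityʳ _))

Ker-empty : (A : Matrix m n) {y : Subset n} → (∀ j → y ! j ≡ false) → Ker A y
Ker-empty A {y} y≡0 i = Σ₂-zero λ j → trans (cong (A i j ∧_) (y≡0 j)) (∧-zeroʳ (A i j))

transpose : Matrix m n → Matrix n m
transpose A j i = A i j

•-⁅⁆ : (i : Fin m) (b : Subset m) → ⁅ i ⁆ • b ≡ b ! i
•-⁅⁆ i b = trans (Σ₂-cong λ k → cong (_∧ b ! k) (!-⁅⁆ i k)) (Σ₂-δ i (b !_))

LinIndep : Matrix m n → Subset n → Set
LinIndep A X = ∀ Y → Y ⊆ᵇ X → Ker A Y → ∀ j → Y ! j ≡ false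

LinDep : Matrix m n → Subset n → Set
LinDep A X = ∃[ Y ] (Y ⊆ᵇ X × Ker A Y × ∃[ j ] (Y ! j ≡ true))

Maximal : Matrix m n → Subset n → Set
Maximal A S = ∀ j → S ! j ≡ false → LinDep A (S ∪ ⁅ j ⁆)

LinIndep⇒¬LinDep : ∀ {A : Matrix m n} {X} → LinIndep A X → ¬ LinDep A X
LinIndep⇒¬LinDep indep (Y , Y⊆X , AY≡0 , j , Yj) = true≢false (trans (sym Yj) (indep Y Y⊆X AY≡0 j))

LinIndep-⊆ : ∀ {A : Matrix m n} {X Y} → LinIndep A X → Y ⊆ᵇ X → LinIndep A Y
LinIndep-⊆ indep Y⊆X W W⊆Y = indep W (λ i → Y⊆X i ∘ W⊆Y i)

LinDep-⊇ : ∀ {A : Matrix m n} {X Y} → LinDep A Y → Y ⊆ᵇ X → LinDep A X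
LinDep-⊇ (W , W⊆Y , AW≡0 , j , Wj) Y⊆X = W , (λ i → Y⊆X i ∘ W⊆Y i) , AW≡0 , j , Wj

LinIndep-⊥ : (A : Matrix m n) → LinIndep A ⊥
LinIndep-⊥ A Y Y⊆⊥ _ j = ⊆ᵇ-elim {Y = Y} {⊥} Y⊆⊥ j (!-⊥ j)

LinIndep-unique : (A : Matrix m n) {S : Subset n} → LinIndep A S → (X Y : Subset n) → X ⊆ᵇ S → Y ⊆ᵇ S →
                  (∀ i → (A · X) i ≡ (A · Y) i) → ∀ i → X ! i ≡ Y ! i
LinIndep-unique A {S} indep X Y X⊆S Y⊆S AX≡AY i = xor≡false⇒≡ (trans (sym (!-△ X Y i)) (indep (X △ Y) X△Y⊆S A[X△Y]≡0 i))
  where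
  X△Y⊆S : (X △ Y) ⊆ᵇ S
  X△Y⊆S k e with X ! k in Xk
  ... | true  = X⊆S k Xk
  ... | false = Y⊆S k (trans (cong (_xor Y ! k) (sym Xk)) (trans (sym (!-△ X Y k)) e))
  A[X△Y]≡0 : Ker A (X △ Y)
  A[X△Y]≡0 k = trans (·-△ A X Y k) (≡⇒xor≡false (AX≡AY k))

allFin≡true⇔ : {f : Fin n → Bool} → allFin f ≡ true ⇔ (∀ i → f i ≡ true)
allFin≡true⇔ = mk⇔ to from
  where
  to : ∀ {n} {f : Fin n → Bool} → allFin f ≡ true → ∀ i → f i ≡ true
  to {f = f} all zero    = ∧-conicalˡ (f zero) _ all
  to {f = f} all (suc i) = to (∧-conicalʳ (f zero) _ all) i
  from : ∀ {n} {f : Fin n → Bool} → (∀ i → f i ≡ true) → allFin f ≡ true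
  from {zero}  _  = refl
  from {suc n} ft rewrite ft zero = from (ft ∘ suc)

allFin-cong : {f g : Fin n → Bool} → (∀ i → f i ≡ g i) → allFin f ≡ allFin g
allFin-cong {zero}  _   = refl
allFin-cong {suc n} f≗g = cong₂ _∧_ (f≗g zero) (allFin-cong (f≗g ∘ suc))

allFin≡false⇒ : {f : Fin n → Bool} → allFin f ≡ false → ∃[ i ] (f i ≡ false)
allFin≡false⇒ {suc n} {f} all with f zero in f0
... | false = zero , f0
... | true with allFin≡false⇒ {f = f ∘ suc} all
... | i , fi = suc i , fi

allList≡true⇒ : ∀ {A : Set} {p : A → Bool} {xs x} → allList p xs ≡ true → x ∈ₗ xs → p x ≡ true
allList≡true⇒ {p = p} {y ∷ _} all (here refl) = ∧-conicalˡ (p y) _ all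
allList≡true⇒ {p = p} {y ∷ _} all (there x∈) = allList≡true⇒ (∧-conicalʳ (p y) _ all) x∈

allList≡true⇐ : ∀ {A : Set} {p : A → Bool} {xs} → (∀ x → x ∈ₗ xs → p x ≡ true) → allList p xs ≡ true
allList≡true⇐ {xs = []}     _  = refl
allList≡true⇐ {xs = x ∷ xs} pt rewrite pt x (here refl) = allList≡true⇐ λ y → pt y ∘ there

allList≡false⇒ : ∀ {A : Set} {p : A → Bool} {xs} → allList p xs ≡ false → ∃[ x ] (p x ≡ false)
allList≡false⇒ {p = p} {x ∷ xs} all with p x in px
... | false = x , px
... | true  = allList≡false⇒ {xs = xs} all

∈-subsets : (Y : Subset n) → Y ∈ₗ subsets n
∈-subsets []                   = here refl
∈-subsets {suc n} (false ∷ Y) = ∈-++⁺ˡ (∈-map⁺ (false ∷_) (∈-subsets Y))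
∈-subsets {suc n} (true ∷ Y)  = ∈-++⁺ʳ (map (false ∷_) (subsets n)) (∈-map⁺ (true ∷_) (∈-subsets Y))

⊆?≡true⇔ : (Y X : Subset n) → (Y ⊆? X) ≡ true ⇔ Y ⊆ᵇ X
⊆?≡true⇔ Y X = mk⇔ (λ t i → Equivalence.to not∨≡true⇔ (Equivalence.to allFin≡true⇔ t i))
                (λ Y⊆X → Equivalence.from allFin≡true⇔ λ i → Equivalence.from not∨≡true⇔ (Y⊆X i))

ker? : Matrix m n → Subset n → Bool
ker? A x = allFin λ i → not ((A · x) i)

ker?≡true⇔ : (A : Matrix m n) (Y : Subset n) → ker? A Y ≡ true ⇔ Ker A Y
ker?≡true⇔ A Y = mk⇔ (λ t i → Equivalence.to not≡true⇔ (Equivalence.to allFin≡true⇔ t i))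
                     (λ AY≡0 → Equivalence.from allFin≡true⇔ λ i → Equivalence.from not≡true⇔ (AY≡0 i))

isEmpty?≡true⇔ : (Y : Subset n) → isEmpty? Y ≡ true ⇔ (∀ j → Y ! j ≡ false)
isEmpty?≡true⇔ Y = mk⇔ (λ t j → Equivalence.to not≡true⇔ (Equivalence.to allFin≡true⇔ t j))
                      (λ Y≡0 → Equivalence.from allFin≡true⇔ λ j → Equivalence.from not≡true⇔ (Y≡0 j))

colIndep?≡true⇔ : (A : Matrix m n) (X : Subset n) → colIndep? A X ≡ true ⇔ LinIndep A X
colIndep?≡true⇔ A X = mk⇔ sound complete
  where
  test : Subset _ → Bool
  test Y = not ((Y ⊆? X) ∧ ker? A Y) ∨ isEmpty? Y
  sound : colIndep? A X ≡ true → LinIndep A X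
  sound t Y Y⊆X AY≡0 = Equivalence.to (isEmpty?≡true⇔ Y)
    (modusPonens (allList≡true⇒ {p = test} {xs = subsets _} t (∈-subsets Y))
                 (Equivalence.from (⊆?≡true⇔ Y X) Y⊆X) (Equivalence.from (ker?≡true⇔ A Y) AY≡0))
    where
    modusPonens : ∀ {a b c} → not (a ∧ b) ∨ c ≡ true → a ≡ true → b ≡ true → c ≡ true
    modusPonens c refl refl = c
  complete : LinIndep A X → colIndep? A X ≡ true
  complete indep = allList≡true⇐ {p = test} {xs = subsets _} λ Y _ → testTrue Y
    where
    testTrue : ∀ Y → test Y ≡ true
    testTrue Y with Y ⊆? X in Y⊆X | ker? A Y in AY≡0
    ... | false | _     = refl
    ... | true  | false = refl
    ... | true  | true  = Equivalence.from (isEmpty?≡true⇔ Y)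
      (indep Y (Equivalence.to (⊆?≡true⇔ Y X) Y⊆X) (Equivalence.to (ker?≡true⇔ A Y) AY≡0))

colIndep?≡false⇒ : {A : Matrix m n} {X : Subset n} → colIndep? A X ≡ false → LinDep A X
colIndep?≡false⇒ {A = A} {X} f with allList≡false⇒ {p = λ Y → not ((Y ⊆? X) ∧ ker? A Y) ∨ isEmpty? Y} {xs = subsets _} f
... | Y , testY with Y ⊆? X in Y⊆X | ker? A Y in AY≡0 | isEmpty? Y in Y≢∅
... | true | true | false with allFin≡false⇒ Y≢∅
...   | j , Yj = Y , Equivalence.to (⊆?≡true⇔ Y X) Y⊆X , Equivalence.to (ker?≡true⇔ A Y) AY≡0 , j , not≡false Yj
  where
  not≡false : ∀ {a} → not a ≡ false → a ≡ true
  not≡false {true} _ = refl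
colIndep?≡false⇒ f | Y , () | false | _     | _
colIndep?≡false⇒ f | Y , () | true  | false | _
colIndep?≡false⇒ f | Y , () | true  | true  | true

LinIndep⊎LinDep : (A : Matrix m n) (X : Subset n) → LinIndep A X ⊎ LinDep A X
LinIndep⊎LinDep A X with colIndep? A X in c
... | true  = inj₁ (Equivalence.to (colIndep?≡true⇔ A X) c)
... | false = inj₂ (colIndep?≡false⇒ {A = A} {X} c)

indepSize : Matrix m n → Subset n → ℕ
indepSize A X = if colIndep? A X then ∣ X ∣ else 0

rank-upper : (A : Matrix m n) (X : Subset n) → LinIndep A X → ∣ X ∣ ≤ rank A
rank-upper A X indep = ≤-trans (size≡ (Equivalence.from (colIndep?≡true⇔ A X) indep)) (∈⇒≤foldr⊔ (∈-map⁺ (indepSize A) (∈-subsets X)))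
  where
  size≡ : colIndep? A X ≡ true → ∣ X ∣ ≤ indepSize A X
  size≡ c rewrite c = ≤-refl
  ∈⇒≤foldr⊔ : ∀ {k ks} → k ∈ₗ ks → k ≤ foldr _⊔_ 0 ks
  ∈⇒≤foldr⊔ {ks = k ∷ ks} (here refl) = m≤m⊔n k _
  ∈⇒≤foldr⊔ {ks = k ∷ ks} (there p)   = ≤-trans (∈⇒≤foldr⊔ p) (m≤n⊔m k _)

rank-attained : (A : Matrix m n) → ∃[ X ] (LinIndep A X × ∣ X ∣ ≡ rank A)
rank-attained {n = n} A with foldr-selective ⊔-sel 0 (map (indepSize A) (subsets n))
... | inj₁ rank≡0 = ⊥ , LinIndep-⊥ A , trans (∣⊥∣≡0 n) (sym rank≡0)
... | inj₂ rank∈ with ∈-map⁻ (indepSize A) rank∈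
...   | X , _ , rank≡size with colIndep? A X in c
...     | true  = X , Equivalence.to (colIndep?≡true⇔ A X) c , sym rank≡size
...     | false = ⊥ , LinIndep-⊥ A , trans (∣⊥∣≡0 n) (sym rank≡size)

LinDep-∪⁅⁆⇒spanned : {A : Matrix m n} {S : Subset n} {j : Fin n} → LinIndep A S → S ! j ≡ false →
                      LinDep A (S ∪ ⁅ j ⁆) → ∃[ c ] (c ⊆ᵇ S × ∀ i → (A · c) i ≡ A i j)
LinDep-∪⁅⁆⇒spanned {A = A} {S} {j} indep Sj (Y , Y⊆S∪j , AY≡0 , k , Yk) with Y ! j in Yj
... | false = ⊥-elim (true≢false (trans (sym Yk) (indep Y Y⊆S AY≡0 k)))
  where
  Y⊆S : Y ⊆ᵇ S
  Y⊆S i Yi with i ≟ j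
  ... | yes refl = ⊥-elim (true≢false (trans (sym Yi) Yj))
  ... | no  i≢j  = trans (sym (∪⁅⁆-≢ S i≢j)) (Y⊆S∪j i Yi)
... | true = Y △ ⁅ j ⁆ , c⊆S , λ i → trans (Ker-△' i) (·-⁅⁆ A j i)
  where
  c⊆S : (Y △ ⁅ j ⁆) ⊆ᵇ S
  c⊆S i ci with i ≟ j
  ... | yes refl = ⊥-elim (true≢false (trans (sym ci) (trans (△⁅⁆-self Y i) (cong not Yj))))
  ... | no  i≢j  = trans (sym (∪⁅⁆-≢ S i≢j)) (Y⊆S∪j i (trans (sym (△⁅⁆-≢ Y i≢j)) ci))
  Ker-△' : ∀ i → (A · (Y △ ⁅ j ⁆)) i ≡ (A · ⁅ j ⁆) i
  Ker-△' i = trans (·-△ A Y ⁅ j ⁆ i) (cong (_xor (A · ⁅ j ⁆) i) (AY≡0 i))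

Maximal⇒⊇ : (A : Matrix m n) {B Y : Subset n} → Maximal A B → LinIndep A Y → B ⊆ᵇ Y → Y ⊆ᵇ B
Maximal⇒⊇ A {B} {Y} B-max Y-indep B⊆Y i Yi =
  ¬-not λ Bi → LinIndep⇒¬LinDep {A = A} {B ∪ ⁅ i ⁆} (LinIndep-⊆ {A = A} {Y} {B ∪ ⁅ i ⁆} Y-indep B∪i⊆Y) (B-max i Bi)
  where
  B∪i⊆Y : (B ∪ ⁅ i ⁆) ⊆ᵇ Y
  B∪i⊆Y k e with k ≟ i
  ... | yes refl = Yi
  ... | no  k≢i  = B⊆Y k (trans (sym (∪⁅⁆-≢ B k≢i)) e)

ColBasis⇔ : (A : Matrix m n) (X : Subset n) → ColBasis A X ⇔ (LinIndep A X × Maximal A X)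
ColBasis⇔ A X = mk⇔
  (λ (indep , maximal) → Equivalence.to (colIndep?≡true⇔ A X) (Equivalence.to T-≡ indep) , λ j Xj → dependent j (maximal j (≡false⇒∉ Xj)))
  (λ (indep , maximal) → Equivalence.from T-≡ (Equivalence.from (colIndep?≡true⇔ A X) indep) ,
    λ j j∉X t → LinIndep⇒¬LinDep {A = A} {X ∪ ⁅ j ⁆} (Equivalence.to (colIndep?≡true⇔ A (X ∪ ⁅ j ⁆)) (Equivalence.to T-≡ t)) (maximal j (∉⇒≡false j∉X)))
  where
  dependent : ∀ j → ¬ T (colIndep? A (X ∪ ⁅ j ⁆)) → LinDep A (X ∪ ⁅ j ⁆)
  dependent j ¬indep with colIndep? A (X ∪ ⁅ j ⁆) in c
  ... | true  = ⊥-elim (¬indep _)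
  ... | false = colIndep?≡false⇒ {A = A} {X ∪ ⁅ j ⁆} c

module Greedy (A : Matrix m n) where

  grow : Fin n → Subset n → Subset n
  grow j X = if colIndep? A (X ∪ ⁅ j ⁆) then X ∪ ⁅ j ⁆ else X

  greedy : List (Fin n) → Subset n → Subset n
  greedy []       X = X
  greedy (j ∷ js) X = greedy js (grow j X)

  ⊆∪⁅⁆ : (X : Subset n) (j : Fin n) → X ⊆ᵇ (X ∪ ⁅ j ⁆)
  ⊆∪⁅⁆ X j i Xi = trans (!-∪ X ⁅ j ⁆ i) (cong (_∨ ⁅ j ⁆ ! i) Xi)

  grow-⊇ : ∀ j X → X ⊆ᵇ grow j X
  grow-⊇ j X with colIndep? A (X ∪ ⁅ j ⁆)
  ... | true  = ⊆∪⁅⁆ X j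
  ... | false = λ _ Xi → Xi

  grow-indep : ∀ j X → LinIndep A X → LinIndep A (grow j X)
  grow-indep j X indep with colIndep? A (X ∪ ⁅ j ⁆) in c
  ... | true  = Equivalence.to (colIndep?≡true⇔ A (X ∪ ⁅ j ⁆)) c
  ... | false = indep

  greedy-⊇ : ∀ js X → X ⊆ᵇ greedy js X
  greedy-⊇ []       X i Xi = Xi
  greedy-⊇ (j ∷ js) X i Xi = greedy-⊇ js (grow j X) i (grow-⊇ j X i Xi)

  greedy-indep : ∀ js X → LinIndep A X → LinIndep A (greedy js X)
  greedy-indep []       X indep = indep
  greedy-indep (j ∷ js) X indep = greedy-indep js (grow j X) (grow-indep j X indep)

  greedy-saturated : ∀ js X j → j ∈ₗ js → greedy js X ! j ≡ true ⊎ LinDep A (greedy js X ∪ ⁅ j ⁆)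
  greedy-saturated (k ∷ js) X j (there j∈js) = greedy-saturated js (grow k X) j j∈js
  greedy-saturated (j ∷ js) X j (here refl) with colIndep? A (X ∪ ⁅ j ⁆) in c
  ... | true  = inj₁ (greedy-⊇ js (X ∪ ⁅ j ⁆) j (∪⁅⁆-self X j))
  ... | false = inj₂ (LinDep-⊇ {A = A} {greedy js X ∪ ⁅ j ⁆} {X ∪ ⁅ j ⁆} (colIndep?≡false⇒ {A = A} {X ∪ ⁅ j ⁆} c) ∪-mono)
    where
    ∪-mono : (X ∪ ⁅ j ⁆) ⊆ᵇ (greedy js X ∪ ⁅ j ⁆)
    ∪-mono i e with i ≟ j
    ... | yes refl = ∪⁅⁆-self (greedy js X) i
    ... | no  i≢j  = trans (∪⁅⁆-≢ (greedy js X) i≢j) (greedy-⊇ js X i (trans (sym (∪⁅⁆-≢ X i≢j)) e))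

  extend-to-basis : ∀ X → LinIndep A X → ∃[ B ] (ColBasis A B × X ⊆ᵇ B)
  extend-to-basis X indep = B , Equivalence.from (ColBasis⇔ A B) (greedy-indep (List.allFin n) X indep , maximal) , greedy-⊇ (List.allFin n) X
    where
    B : Subset n
    B = greedy (List.allFin n) X
    maximal : Maximal A B
    maximal j Bj with greedy-saturated (List.allFin n) X j (∈-allFin j)
    ... | inj₁ Bj′ = ⊥-elim (true≢false (trans (sym Bj′) Bj))
    ... | inj₂ dep = dep

∑ : (Subset n → ℕ) → ℕ
∑ {zero}  f = f []
∑ {suc n} f = ∑ (f ∘ (false ∷_)) + ∑ (f ∘ (true ∷_))

count : (Subset n → Bool) → ℕ
count p = ∑ λ x → if p x then 1 else 0

∑-cong : {f g : Subset n → ℕ} → (∀ x → f x ≡ g x) → ∑ f ≡ ∑ g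
∑-cong {zero}  f≗g = f≗g []
∑-cong {suc n} f≗g = cong₂ _+_ (∑-cong (f≗g ∘ (false ∷_))) (∑-cong (f≗g ∘ (true ∷_)))

∑-zero : ∑ {n} (λ _ → 0) ≡ 0
∑-zero {zero}  = refl
∑-zero {suc n} = cong₂ _+_ (∑-zero {n}) (∑-zero {n})

∑-+ : (f g : Subset n → ℕ) → ∑ (λ x → f x + g x) ≡ ∑ f + ∑ g
∑-+ {zero}  f g = refl
∑-+ {suc n} f g = trans (cong₂ _+_ (∑-+ (f ∘ (false ∷_)) (g ∘ (false ∷_))) (∑-+ (f ∘ (true ∷_)) (g ∘ (true ∷_))))
                        (interchange (∑ (f ∘ (false ∷_))) _ _ _)

∑-swap : (f : Subset m → Subset n → ℕ) → ∑ (λ x → ∑ (f x)) ≡ ∑ (λ y → ∑ (λ x → f x y))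
∑-swap {zero}  f = refl
∑-swap {suc m} f = trans (cong₂ _+_ (∑-swap (f ∘ (false ∷_))) (∑-swap (f ∘ (true ∷_))))
                         (sym (∑-+ (λ y → ∑ (λ x → f (false ∷ x) y)) (λ y → ∑ (λ x → f (true ∷ x) y))))

_≟ˢ_ : DecidableEquality (Subset n)
_≟ˢ_ = ≡-dec _≟ᴮ_

∑-sift : (y : Subset n) (h : Subset n → ℕ) → ∑ (λ x → if does (x ≟ˢ y) then h x else 0) ≡ h y
∑-sift                 []          h = refl
∑-sift {n = suc n} (false ∷ y) h = trans (cong (_+ _) (∑-sift y (h ∘ (false ∷_))))
                                         (trans (cong (h (false ∷ y) +_) (∑-zero {n})) (+-identityʳ _))
∑-sift {n = suc n} (true ∷ y)  h = trans (cong (_+ ∑ (λ x → if does (x ≟ˢ y) then h (true ∷ x) else 0)) (∑-zero {n})) (∑-sift y (h ∘ (true ∷_)))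

∑-involution : (f : Subset n → Subset n) → (∀ x → f (f x) ≡ x) → (h : Subset n → ℕ) → ∑ (h ∘ f) ≡ ∑ h
∑-involution f f-invol h = begin
  ∑ (λ x → h (f x))                                            ≡⟨ ∑-cong (λ x → ∑-sift (f x) h) ⟨
  ∑ (λ x → ∑ (λ y → if does (y ≟ˢ f x) then h y else 0))      ≡⟨ ∑-swap (λ x y → if does (y ≟ˢ f x) then h y else 0) ⟩
  ∑ (λ y → ∑ (λ x → if does (y ≟ˢ f x) then h y else 0))      ≡⟨ ∑-cong (λ y → ∑-cong λ x → cong (if_then h y else 0) (graph-symmetric y x)) ⟩
  ∑ (λ y → ∑ (λ x → if does (x ≟ˢ f y) then h y else 0))      ≡⟨ ∑-cong (λ y → ∑-sift (f y) (λ _ → h y)) ⟩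
  ∑ h                                                          ∎
  where
  open ≡-Reasoning
  graph-symmetric : ∀ y x → does (y ≟ˢ f x) ≡ does (x ≟ˢ f y)
  graph-symmetric y x with y ≟ˢ f x | x ≟ˢ f y
  ... | yes _      | yes _      = refl
  ... | no  _      | no  _      = refl
  ... | yes refl   | no  x≢ffx  = ⊥-elim (x≢ffx (sym (f-invol x)))
  ... | no  y≢fx   | yes refl   = ⊥-elim (y≢fx (sym (f-invol y)))

count-cong : {p q : Subset n → Bool} → (∀ x → p x ≡ q x) → count p ≡ count q
count-cong p≗q = ∑-cong λ x → cong (if_then 1 else 0) (p≗q x)

count-split : (p q : Subset n → Bool) → count p ≡ count (λ x → p x ∧ q x) + count (λ x → p x ∧ not (q x))
count-split p q = trans (∑-cong λ x → split (p x) (q x))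
                        (∑-+ (λ x → if p x ∧ q x then 1 else 0) (λ x → if p x ∧ not (q x) then 1 else 0))
  where
  split : ∀ a b → (if a then 1 else 0) ≡ (if a ∧ b then 1 else 0) + (if a ∧ not b then 1 else 0)
  split false b     = refl
  split true  false = refl
  split true  true  = refl

count-△ : (p : Subset n → Bool) (y : Subset n) → count (λ x → p (x △ y)) ≡ count p
count-△ p y = ∑-involution (_△ y) (λ x → △-cancelʳ x y) (λ x → if p x then 1 else 0)

disjoint? : Subset n → Subset n → Bool
disjoint? s x = allFin λ i → not (x ! i ∧ s ! i)

disjoint?≡true⇔ : (S y : Subset n) → disjoint? S y ≡ true ⇔ (∀ i → (y ∩ S) ! i ≡ false)
disjoint?≡true⇔ S y = mk⇔ (λ d i → trans (!-∩ y S i) (Equivalence.to not≡true⇔ (Equivalence.to allFin≡true⇔ d i)))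
                           (λ e → Equivalence.from allFin≡true⇔ λ i → Equivalence.from not≡true⇔ (trans (sym (!-∩ y S i)) (e i)))

count-disjoint : (s : Subset n) → count (disjoint? s) ≡ 2 ^ (n ∸ ∣ s ∣)
count-disjoint                 []         = refl
count-disjoint {n = suc n} (true ∷ s)  = trans (cong (count (disjoint? s) +_) (∑-zero {n}))
                                              (trans (+-identityʳ _) (count-disjoint s))
count-disjoint {n = suc n} (false ∷ s) rewrite count-disjoint s | +-∸-assoc 1 (∣p∣≤n s) =
  cong (2 ^ (n ∸ ∣ s ∣) +_) (sym (+-identityʳ _))

count-insertAt : (v : Fin (suc n)) (q : Subset (suc n) → Bool) →
                 count (λ x → q (insertAt x v false)) ≡ count (λ x → not (x ! v) ∧ q x)
count-insertAt {n}     zero    q = sym (trans (cong (count (q ∘ (false ∷_)) +_) (∑-zero {n})) (+-identityʳ _))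
count-insertAt {suc n} (suc v) q = cong₂ _+_ (count-insertAt v (q ∘ (false ∷_))) (count-insertAt v (q ∘ (true ∷_)))

2^-injective : ∀ a b → 2 ^ a ≡ 2 ^ b → a ≡ b
2^-injective a b e = trans (sym (⌊log₂[2^n]⌋≡n a)) (trans (cong ⌊log₂_⌋ e) (⌊log₂[2^n]⌋≡n b))

-- Rank–nullity

-- shear is an involution of Subset n carrying ker A onto the sets disjoint from S, which gives ∣ker A∣ = 2^(n − ∣S∣).
module MaximalIndependent (A : Matrix m n) (S : Subset n) (S-indep : LinIndep A S) (S-maximal : Maximal A S) where

  private
    spanning : ∀ j → ∃[ c ] (c ⊆ᵇ S × (S ! j ≡ false → ∀ i → (A · c) i ≡ A i j))
    spanning j with S ! j in Sj
    ... | true  = ⊥ , (λ i ⊥i → ⊥-elim (true≢false (trans (sym ⊥i) (!-⊥ i)))) , λ ()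
    ... | false with LinDep-∪⁅⁆⇒spanned {A = A} {S} S-indep Sj (S-maximal j Sj)
    ...   | c , c⊆S , Ac≡Aj = c , c⊆S , λ _ → Ac≡Aj

  column : Fin n → Subset n
  column j = proj₁ (spanning j)

  column⊆S : ∀ j → column j ⊆ᵇ S
  column⊆S j = proj₁ (proj₂ (spanning j))

  ·-column : ∀ j → S ! j ≡ false → ∀ i → (A · column j) i ≡ A i j
  ·-column j = proj₂ (proj₂ (spanning j))

  lift : Subset n → Subset n
  lift y = combination (y !_) column

  shear : Subset n → Subset n
  shear x = x △ lift (x ∩ ∁ S)

  lift⊆S : ∀ y → lift y ⊆ᵇ S
  lift⊆S y = combination-⊆ {S = S} (y !_) column column⊆S

  ·-lift : ∀ x i → (A · lift (x ∩ ∁ S)) i ≡ (A · (x ∩ ∁ S)) i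
  ·-lift x i = trans (·-combination A ((x ∩ ∁ S) !_) column i) (Σ₂-cong pointwise)
    where
    pointwise : ∀ j → (x ∩ ∁ S) ! j ∧ (A · column j) i ≡ A i j ∧ (x ∩ ∁ S) ! j
    pointwise j rewrite !-∩∁ x S j = guarded (x ! j) (S ! j) (λ Sj → ·-column j Sj i)
      where
      guarded : ∀ a s {r b} → (s ≡ false → r ≡ b) → (a ∧ not s) ∧ r ≡ b ∧ (a ∧ not s)
      guarded a true  {b = b} _ rewrite ∧-zeroʳ a = sym (∧-zeroʳ b)
      guarded a false {r} {b} r≡b rewrite r≡b refl = ∧-comm (a ∧ true) b

  shear-∩∁ : ∀ x → shear x ∩ ∁ S ≡ x ∩ ∁ S
  shear-∩∁ x = ≗⇒≡ λ j → begin
    (shear x ∩ ∁ S) ! j                                   ≡⟨ !-∩∁ (shear x) S j ⟩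
    shear x ! j ∧ not (S ! j)                             ≡⟨ cong (_∧ not (S ! j)) (!-△ x _ j) ⟩
    (x ! j xor lift (x ∩ ∁ S) ! j) ∧ not (S ! j)          ≡⟨ offS (x ! j) (S ! j) (⊆ᵇ-elim {Y = lift (x ∩ ∁ S)} {S} (lift⊆S (x ∩ ∁ S)) j) ⟩
    x ! j ∧ not (S ! j)                                   ≡⟨ !-∩∁ x S j ⟨
    (x ∩ ∁ S) ! j                                         ∎
    where
    open ≡-Reasoning
    offS : ∀ a s {b} → (s ≡ false → b ≡ false) → (a xor b) ∧ not s ≡ a ∧ not s
    offS a true  {b} _ = trans (∧-zeroʳ (a xor b)) (sym (∧-zeroʳ a))
    offS a false b≡0 rewrite b≡0 refl | xor-identityʳ a = refl

  shear-involutive : ∀ x → shear (shear x) ≡ x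
  shear-involutive x = trans (cong (λ y → shear x △ lift y) (shear-∩∁ x)) (△-cancelʳ x (lift (x ∩ ∁ S)))

  ·-shear∩S : ∀ x i → (A · (shear x ∩ S)) i ≡ (A · x) i
  ·-shear∩S x i = begin
    (A · (shear x ∩ S)) i                                       ≡⟨ xor-moveʳ (·-split A S (shear x) i) ⟩
    (A · shear x) i xor (A · (shear x ∩ ∁ S)) i                 ≡⟨ cong₂ _xor_ (·-△ A x _ i) (cong (λ y → (A · y) i) (shear-∩∁ x)) ⟩
    ((A · x) i xor (A · lift (x ∩ ∁ S)) i) xor (A · (x ∩ ∁ S)) i ≡⟨ cong (λ b → ((A · x) i xor b) xor (A · (x ∩ ∁ S)) i) (·-lift x i) ⟩
    ((A · x) i xor (A · (x ∩ ∁ S)) i) xor (A · (x ∩ ∁ S)) i     ≡⟨ xor-cancelʳ _ _ ⟩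
    (A · x) i                                                   ∎
    where open ≡-Reasoning

  Ker⇔shear∩S≡∅ : ∀ x → Ker A x ⇔ (∀ i → (shear x ∩ S) ! i ≡ false)
  Ker⇔shear∩S≡∅ x = mk⇔
    (λ Ax≡0 → S-indep (shear x ∩ S) (λ i e → ∧-conicalʳ _ _ (trans (sym (!-∩ (shear x) S i)) e))
                      (λ i → trans (·-shear∩S x i) (Ax≡0 i)))
    (λ empty i → trans (sym (·-shear∩S x i)) (Ker-empty A {shear x ∩ S} empty i))

  ker?≡disjoint?∘shear : ∀ x → ker? A x ≡ disjoint? S (shear x)
  ker?≡disjoint?∘shear x = Bool-ext (mk⇔
    (λ k → Equivalence.from (disjoint?≡true⇔ S (shear x)) (Equivalence.to (Ker⇔shear∩S≡∅ x) (Equivalence.to (ker?≡true⇔ A x) k)))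
    (λ d → Equivalence.from (ker?≡true⇔ A x) (Equivalence.from (Ker⇔shear∩S≡∅ x) (Equivalence.to (disjoint?≡true⇔ S (shear x)) d))))

  count-ker : count (ker? A) ≡ 2 ^ (n ∸ ∣ S ∣)
  count-ker = begin
    count (ker? A)                     ≡⟨ count-cong ker?≡disjoint?∘shear ⟩
    count (disjoint? S ∘ shear)        ≡⟨ ∑-involution shear shear-involutive (λ x → if disjoint? S x then 1 else 0) ⟩
    count (disjoint? S)                ≡⟨ count-disjoint S ⟩
    2 ^ (n ∸ ∣ S ∣)                    ∎
    where open ≡-Reasoning

LinIndep∧rank⇒Maximal : (A : Matrix m n) (S : Subset n) → LinIndep A S → ∣ S ∣ ≡ rank A → Maximal A S
LinIndep∧rank⇒Maximal A S _ ∣S∣≡rank j Sj with LinIndep⊎LinDep A (S ∪ ⁅ j ⁆)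
... | inj₂ dep   = dep
... | inj₁ indep = ⊥-elim (<⇒≱ (p⊂q⇒∣p∣<∣q∣ (⊂∪⁅⁆ {S = S} {j} Sj)) (≤-trans (rank-upper A (S ∪ ⁅ j ⁆) indep) (≤-reflexive (sym ∣S∣≡rank))))

count-ker≡2^[n∸rank] : (A : Matrix m n) → count (ker? A) ≡ 2 ^ (n ∸ rank A)
count-ker≡2^[n∸rank] A with rank-attained A
... | S , S-indep , ∣S∣≡rank = trans (MaximalIndependent.count-ker A S S-indep (LinIndep∧rank⇒Maximal A S S-indep ∣S∣≡rank))
                                     (cong (λ r → 2 ^ (_ ∸ r)) ∣S∣≡rank)

Maximal⇒∣∣≡rank : (A : Matrix m n) (S : Subset n) → LinIndep A S → Maximal A S → ∣ S ∣ ≡ rank A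
Maximal⇒∣∣≡rank {n = n} A S S-indep S-maximal with rank-attained A
... | T , _ , ∣T∣≡rank = ∸-cancelˡ-≡ (∣p∣≤n S) (subst (_≤ n) ∣T∣≡rank (∣p∣≤n T))
  (2^-injective _ _ (trans (sym (MaximalIndependent.count-ker A S S-indep S-maximal)) (count-ker≡2^[n∸rank] A)))

-- The Fredholm alternative

module Elimination (A : Matrix m (suc n)) (b : Subset m) {i₀ : Fin m} (pivot : A i₀ zero ≡ true) where

  a : Fin m → Bool
  a i = A i zero

  A′ : Matrix m n
  A′ i j = A i (suc j)

  A″ : Matrix m n
  A″ k j = A′ k j xor (a k ∧ A′ i₀ j)

  b″ : Subset m
  b″ = tabulate λ k → b ! k xor (a k ∧ b ! i₀)

  orthogonal : (∀ y → Ker (transpose A) y → y • b ≡ false) → ∀ y → Ker (transpose A″) y → y • b″ ≡ false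
  orthogonal b⊥ y A″ᵀy≡0 = begin
    y • b″                                            ≡⟨ Σ₂-cong (λ k → trans (cong (y ! k ∧_) (!-tabulate _ k)) (∧-comm (y ! k) _)) ⟩
    Σ₂ (λ k → (b ! k xor (a k ∧ b ! i₀)) ∧ y ! k)     ≡⟨ Σ₂-perturbˡ (b ! i₀) (b !_) a (y !_) ⟩
    Σ₂ (λ k → b ! k ∧ y ! k) xor (b ! i₀ ∧ s)         ≡⟨ Σ₂-perturbʳ i₀ s (b !_) (y !_) ⟨
    Σ₂ (λ k → b ! k ∧ (y ! k xor (δ k i₀ ∧ s)))       ≡⟨ Σ₂-cong (λ k → trans (∧-comm (y* ! k) (b ! k)) (cong (b ! k ∧_) (!-y* k))) ⟨
    y* • b                                            ≡⟨ b⊥ y* Aᵀy*≡0 ⟩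
    false                                             ∎
    where
    open ≡-Reasoning
    s : Bool
    s = Σ₂ λ k → a k ∧ y ! k
    y* : Subset m
    y* = tabulate λ k → y ! k xor (δ k i₀ ∧ s)
    !-y* : ∀ k → y* ! k ≡ y ! k xor (δ k i₀ ∧ s)
    !-y* = !-tabulate _
    ᵀ·y* : ∀ (f : Fin m → Bool) → Σ₂ (λ k → f k ∧ y* ! k) ≡ Σ₂ (λ k → f k ∧ y ! k) xor (f i₀ ∧ s)
    ᵀ·y* f = trans (Σ₂-cong λ k → cong (f k ∧_) (!-y* k)) (Σ₂-perturbʳ i₀ s f (y !_))
    Aᵀy*≡0 : Ker (transpose A) y*
    Aᵀy*≡0 zero    = trans (ᵀ·y* a) (trans (cong (λ p → s xor (p ∧ s)) pivot) (xor-same s))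
    Aᵀy*≡0 (suc j) = trans (ᵀ·y* (λ k → A′ k j))
                           (trans (sym (Σ₂-perturbˡ (A′ i₀ j) (λ k → A′ k j) a (y !_))) (A″ᵀy≡0 j))

  back-substitution : ∀ x′ → (∀ k → (A″ · x′) k ≡ b″ ! k) → ∀ k → (A · ((b ! i₀ xor (A′ · x′) i₀) ∷ x′)) k ≡ b ! k
  back-substitution x′ A″x′≡b″ k =
    trans (cong ((a k ∧ (b ! i₀ xor (A′ · x′) i₀)) xor_) (xor-moveʳ (sym A′x′≡)))
          (solve (a k) (b ! i₀) ((A′ · x′) i₀) (b ! k))
    where
    solve : ∀ a b₀ q bₖ → (a ∧ (b₀ xor q)) xor ((bₖ xor (a ∧ b₀)) xor (a ∧ q)) ≡ bₖ
    solve = solve-∀ GF2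
    A′x′≡ : (A′ · x′) k xor (a k ∧ (A′ · x′) i₀) ≡ b ! k xor (a k ∧ b ! i₀)
    A′x′≡ = begin
      (A′ · x′) k xor (a k ∧ (A′ · x′) i₀)               ≡⟨ Σ₂-perturbˡ (a k) (A′ k) (λ j → A′ i₀ j) (x′ !_) ⟨
      Σ₂ (λ j → (A′ k j xor (A′ i₀ j ∧ a k)) ∧ x′ ! j)  ≡⟨ Σ₂-cong (λ j → cong (λ t → (A′ k j xor t) ∧ x′ ! j) (∧-comm (A′ i₀ j) (a k))) ⟩
      (A″ · x′) k                                       ≡⟨ A″x′≡b″ k ⟩
      b″ ! k                                            ≡⟨ !-tabulate _ k ⟩
      b ! k xor (a k ∧ b ! i₀)                          ∎
      where open ≡-Reasoning

fredholm : (A : Matrix m n) (b : Subset m) → (∀ y → Ker (transpose A) y → y • b ≡ false) →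
           ∃[ x ] (∀ i → (A · x) i ≡ b ! i)
fredholm {n = zero} A b b⊥ = [] , λ i → sym (trans (sym (•-⁅⁆ i b)) (b⊥ ⁅ i ⁆ λ ()))
fredholm {n = suc n} A b b⊥ with any? (λ i → A i zero ≟ᴮ true)
... | yes (i₀ , pivot) =
  let open Elimination A b pivot
      x′ , A″x′≡b″ = fredholm A″ b″ (orthogonal b⊥)
  in  (b ! i₀ xor (A′ · x′) i₀) ∷ x′ , back-substitution x′ A″x′≡b″
... | no no-pivot =
  let x′ , A′x′≡b = fredholm (λ i j → A i (suc j)) b λ y A′ᵀy≡0 → b⊥ y λ where
                      zero    → Σ₂-zero λ i → cong (_∧ y ! i) (column₀≡0 i)
                      (suc j) → A′ᵀy≡0 j
  in  false ∷ x′ , λ i → trans (cong (_xor Σ₂ (λ j → A i (suc j) ∧ x′ ! j)) (∧-zeroʳ (A i zero))) (A′x′≡b i)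
  where
  column₀≡0 : ∀ i → A i zero ≡ false
  column₀≡0 i = ¬-not λ Ai0 → no-pivot (i , Ai0)

-- Nullities of H, H ∖ v and H + v

·-+ₗ : (H : Graph n) (X x : Subset n) (i : Fin n) → ((H +ₗ X) · x) i ≡ (H · x) i xor (X ! i ∧ x ! i)
·-+ₗ H X x i = trans (Σ₂-perturbˡ (X ! i) (H i) (δ i) (x !_))
                     (cong (λ s → (H · x) i xor (X ! i ∧ s)) (trans (Σ₂-cong λ j → cong (_∧ x ! j) (δ-sym i j)) (Σ₂-δ i (x !_))))

Solves : Graph n → Fin n → Subset n → Set
Solves H v y = ∀ i → (H · y) i ≡ δ i v

Rᴴ Pᴴ Qᴴ : Graph n → Fin n → Set
Rᴴ H v = ∃[ x ] (Ker H x × x ! v ≡ true)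
Pᴴ H v = ∃[ y ] (Solves H v y × y ! v ≡ true)
Qᴴ H v = ∃[ y ] (Solves H v y × y ! v ≡ false)

module _ {H : Graph n} (H-sym : Symmetric H) {v : Fin n} where

  Ker⇒∌ : ∀ k y → Solves H v y → Ker H k → k ! v ≡ false
  Ker⇒∌ k y Hy≡eᵥ Hk≡0 = begin
    k ! v                         ≡⟨ Σ₂-δ v (k !_) ⟨
    Σ₂ (λ i → δ i v ∧ k ! i)      ≡⟨ Σ₂-cong (λ i → trans (∧-comm (δ i v) (k ! i)) (cong (k ! i ∧_) (sym (Hy≡eᵥ i)))) ⟩
    Σ₂ (λ i → k ! i ∧ (H · y) i)  ≡⟨ ·-selfAdjoint H H-sym k y ⟩
    Σ₂ (λ j → y ! j ∧ (H · k) j)  ≡⟨ Σ₂-zero (λ j → trans (cong (y ! j ∧_) (Hk≡0 j)) (∧-zeroʳ (y ! j))) ⟩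
    false                         ∎
    where open ≡-Reasoning

  Rᴴ⇒¬Solves : Rᴴ H v → ∀ y → ¬ Solves H v y
  Rᴴ⇒¬Solves (k , Hk≡0 , kᵥ) y Hy≡eᵥ = true≢false (trans (sym kᵥ) (Ker⇒∌ k y Hy≡eᵥ Hk≡0))

Solves⇔Ker-△ : (H : Graph n) (v : Fin n) (x y : Subset n) → Solves H v y → Solves H v x ⇔ Ker H (x △ y)
Solves⇔Ker-△ H v x y Hy≡eᵥ = mk⇔
  (λ Hx≡eᵥ i → trans (·-△ H x y i) (≡⇒xor≡false (trans (Hx≡eᵥ i) (sym (Hy≡eᵥ i)))))
  (λ H[x△y]≡0 i → trans (xor-moveʳ (·-△ H x y i)) (cong₂ _xor_ (H[x△y]≡0 i) (Hy≡eᵥ i)))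

module Nullities {H : Graph (suc n)} (H-sym : Symmetric H) (v : Fin (suc n)) where

  K L : Subset (suc n) → Bool
  K = ker? H
  L = ker? (H +ₗ ⁅ v ⁆)

  VanishesOffV : Subset (suc n) → Set
  VanishesOffV x = ∀ i → i ≢ v → (H · x) i ≡ false

  vanishesOffV? : Subset (suc n) → Bool
  vanishesOffV? x = allFin λ i → δ i v ∨ not ((H · x) i)

  vanishesOffV?≡true⇔ : ∀ x → vanishesOffV? x ≡ true ⇔ VanishesOffV x
  vanishesOffV?≡true⇔ x = mk⇔
    (λ t i i≢v → Equivalence.to not≡true⇔ (subst (λ d → d ∨ not ((H · x) i) ≡ true) (δ-≢ i≢v) (Equivalence.to (allFin≡true⇔ {f = test}) t i)))
    (λ off → Equivalence.from (allFin≡true⇔ {f = test}) λ i → pointwise i (off i))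
    where
    test : Fin (suc n) → Bool
    test i = δ i v ∨ not ((H · x) i)
    pointwise : ∀ i → (i ≢ v → (H · x) i ≡ false) → δ i v ∨ not ((H · x) i) ≡ true
    pointwise i off with i ≟ v
    ... | yes _   = refl
    ... | no  i≢v = Equivalence.from not≡true⇔ (off i≢v)

  VanishesOffV⇒Ker : ∀ x → VanishesOffV x → (H · x) v ≡ false → Ker H x
  VanishesOffV⇒Ker x off Hxᵥ i with i ≟ v
  ... | yes refl = Hxᵥ
  ... | no  i≢v  = off i i≢v

  VanishesOffV⇒Solves : ∀ x → VanishesOffV x → (H · x) v ≡ true → Solves H v x
  VanishesOffV⇒Solves x off Hxᵥ i with i ≟ v
  ... | yes refl = Hxᵥ
  ... | no  i≢v  = off i i≢v

  Ker⇒VanishesOffV : ∀ x → Ker H x → VanishesOffV x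
  Ker⇒VanishesOffV x Hx≡0 i _ = Hx≡0 i

  Solves⇒VanishesOffV : ∀ x → Solves H v x → VanishesOffV x
  Solves⇒VanishesOffV x Hx≡eᵥ i i≢v = trans (Hx≡eᵥ i) (δ-≢ i≢v)

  ·-+ₗ⁅v⁆ : ∀ x i → ((H +ₗ ⁅ v ⁆) · x) i ≡ (H · x) i xor (δ i v ∧ x ! v)
  ·-+ₗ⁅v⁆ x i = trans (·-+ₗ H ⁅ v ⁆ x i) (cong ((H · x) i xor_) (at-v i))
    where
    at-v : ∀ i → ⁅ v ⁆ ! i ∧ x ! i ≡ δ i v ∧ x ! v
    at-v i with i ≟ v
    ... | yes refl = cong (_∧ x ! i) (⁅⁆-self i)
    ... | no  i≢v  = cong (_∧ x ! i) (⁅⁆-≢ i≢v)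

  L≡K : ∀ x → x ! v ≡ false → L x ≡ K x
  L≡K x xᵥ = allFin-cong {f = λ i → not (((H +ₗ ⁅ v ⁆) · x) i)} λ i → cong not (trans (·-+ₗ⁅v⁆ x i)
    (trans (cong (λ b → (H · x) i xor (δ i v ∧ b)) xᵥ) (trans (cong ((H · x) i xor_) (∧-zeroʳ (δ i v))) (xor-identityʳ ((H · x) i)))))

  ·-+ₗ⁅v⁆-∋ : ∀ x → x ! v ≡ true → ∀ i → ((H +ₗ ⁅ v ⁆) · x) i ≡ (H · x) i xor δ i v
  ·-+ₗ⁅v⁆-∋ x xᵥ i = trans (·-+ₗ⁅v⁆ x i) (trans (cong (λ b → (H · x) i xor (δ i v ∧ b)) xᵥ) (cong ((H · x) i xor_) (∧-identityʳ (δ i v))))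

  L⇔Solves : ∀ x → x ! v ≡ true → L x ≡ true ⇔ Solves H v x
  L⇔Solves x xᵥ = mk⇔
    (λ t i → xor≡false⇒≡ (trans (sym (·-+ₗ⁅v⁆-∋ x xᵥ i)) (Equivalence.to (ker?≡true⇔ (H +ₗ ⁅ v ⁆) x) t i)))
    (λ Hx≡eᵥ → Equivalence.from (ker?≡true⇔ (H +ₗ ⁅ v ⁆) x) λ i → trans (·-+ₗ⁅v⁆-∋ x xᵥ i) (≡⇒xor≡false (Hx≡eᵥ i)))

  ·-∖ᵥ : ∀ (x′ : Subset n) i → ((H ∖ᵥ v) · x′) i ≡ (H · insertAt x′ v false) (punchIn v i)
  ·-∖ᵥ x′ i = sym (begin
    Σ₂ (λ j → H (punchIn v i) j ∧ x ! j)                                    ≡⟨ Σ₂-punchIn v (λ j → H (punchIn v i) j ∧ x ! j) ⟩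
    (H (punchIn v i) v ∧ x ! v) xor Σ₂ (λ j → H (punchIn v i) (punchIn v j) ∧ x ! punchIn v j)
      ≡⟨ cong (_xor Σ₂ (λ j → H (punchIn v i) (punchIn v j) ∧ x ! punchIn v j)) (trans (cong (H (punchIn v i) v ∧_) (insertAt-lookup x′ v false)) (∧-zeroʳ _)) ⟩
    Σ₂ (λ j → H (punchIn v i) (punchIn v j) ∧ x ! punchIn v j)              ≡⟨ Σ₂-cong (λ j → cong (H (punchIn v i) (punchIn v j) ∧_) (insertAt-punchIn x′ v false j)) ⟩
    Σ₂ (λ j → H (punchIn v i) (punchIn v j) ∧ x′ ! j)                       ∎)
    where
    open ≡-Reasoning
    x : Subset (suc n)
    x = insertAt x′ v false

  Ker-∖ᵥ⇔VanishesOffV : ∀ x′ → Ker (H ∖ᵥ v) x′ ⇔ VanishesOffV (insertAt x′ v false)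
  Ker-∖ᵥ⇔VanishesOffV x′ = mk⇔
    (λ ker i i≢v → subst (λ j → (H · insertAt x′ v false) j ≡ false) (punchIn-punchOut (i≢v ∘ sym))
                         (trans (sym (·-∖ᵥ x′ _)) (ker _)))
    (λ off i → trans (·-∖ᵥ x′ i) (off (punchIn v i) (punchInᵢ≢i v i)))

  count-∖ᵥ : count (ker? (H ∖ᵥ v)) ≡ count (λ x → not (x ! v) ∧ vanishesOffV? x)
  count-∖ᵥ = trans (count-cong λ x′ → Bool-ext (mk⇔
      (λ k → Equivalence.from (vanishesOffV?≡true⇔ (insertAt x′ v false)) (Equivalence.to (Ker-∖ᵥ⇔VanishesOffV x′) (Equivalence.to (ker?≡true⇔ (H ∖ᵥ v) x′) k)))
      (λ o → Equivalence.from (ker?≡true⇔ (H ∖ᵥ v) x′) (Equivalence.from (Ker-∖ᵥ⇔VanishesOffV x′) (Equivalence.to (vanishesOffV?≡true⇔ (insertAt x′ v false)) o)))))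
    (count-insertAt v vanishesOffV?)

  private
    Ker?⇒Ker : ∀ x → K x ≡ true → Ker H x
    Ker?⇒Ker x = Equivalence.to (ker?≡true⇔ H x)

    Ker⇒Ker? : ∀ x → Ker H x → K x ≡ true
    Ker⇒Ker? x = Equivalence.from (ker?≡true⇔ H x)

    flip-v : ∀ (x y : Subset (suc n)) → y ! v ≡ true → (x △ y) ! v ≡ not (x ! v)
    flip-v x y yᵥ = trans (!-△ x y v) (trans (cong (x ! v xor_) yᵥ) (xor-true (x ! v)))

  vanishesOffV?≡K : ∀ x → ¬ Solves H v x → vanishesOffV? x ≡ K x
  vanishesOffV?≡K x ¬hits = Bool-ext (mk⇔ to λ k → Equivalence.from (vanishesOffV?≡true⇔ x) (Ker⇒VanishesOffV x (Ker?⇒Ker x k)))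
    where
    to : vanishesOffV? x ≡ true → K x ≡ true
    to o with (H · x) v in Hxᵥ
    ... | false = Ker⇒Ker? x (VanishesOffV⇒Ker x (Equivalence.to (vanishesOffV?≡true⇔ x) o) Hxᵥ)
    ... | true  = ⊥-elim (¬hits (VanishesOffV⇒Solves x (Equivalence.to (vanishesOffV?≡true⇔ x) o) Hxᵥ))

  K≡K∘△ : ∀ k → Ker H k → ∀ x → K (x △ k) ≡ K x
  K≡K∘△ k Hk≡0 x = allFin-cong {f = λ i → not ((H · (x △ k)) i)} λ i → cong not (Ker-△ H x k Hk≡0 i)

  counts-R : Rᴴ H v → count K ≡ count L + count L × count (ker? (H ∖ᵥ v)) ≡ count L
  counts-R R@(k , Hk≡0 , kᵥ) = count-K , trans count-∖ᵥ (count-cong pointwise)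
    where
    L≡K∧¬ᵥ : ∀ x → L x ≡ K x ∧ not (x ! v)
    L≡K∧¬ᵥ x with x ! v in xᵥ
    ... | false = trans (L≡K x xᵥ) (sym (∧-identityʳ (K x)))
    ... | true  = trans (¬-not λ Lx → Rᴴ⇒¬Solves H-sym R x (Equivalence.to (L⇔Solves x xᵥ) Lx)) (sym (∧-zeroʳ (K x)))

    shifted : ∀ x → K x ∧ not (not (x ! v)) ≡ K (x △ k) ∧ not ((x △ k) ! v)
    shifted x = cong₂ _∧_ (sym (K≡K∘△ k Hk≡0 x)) (cong not (sym (flip-v x k kᵥ)))

    count-K : count K ≡ count L + count L
    count-K = begin
      count K                                                                     ≡⟨ count-split K (λ x → not (x ! v)) ⟩
      count (λ x → K x ∧ not (x ! v)) + count (λ x → K x ∧ not (not (x ! v)))     ≡⟨ cong (count (λ x → K x ∧ not (x ! v)) +_) (count-cong shifted) ⟩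
      count (λ x → K x ∧ not (x ! v)) + count (λ x → K (x △ k) ∧ not ((x △ k) ! v)) ≡⟨ cong (count (λ x → K x ∧ not (x ! v)) +_) (count-△ (λ x → K x ∧ not (x ! v)) k) ⟩
      count (λ x → K x ∧ not (x ! v)) + count (λ x → K x ∧ not (x ! v))           ≡⟨ cong₂ _+_ (count-cong (sym ∘ L≡K∧¬ᵥ)) (count-cong (sym ∘ L≡K∧¬ᵥ)) ⟩
      count L + count L                                                           ∎
      where open ≡-Reasoning

    pointwise : ∀ x → not (x ! v) ∧ vanishesOffV? x ≡ L x
    pointwise x with x ! v in xᵥ
    ... | true  = sym (trans (L≡K∧¬ᵥ x) (trans (cong (λ b → K x ∧ not b) xᵥ) (∧-zeroʳ (K x))))
    ... | false = trans (vanishesOffV?≡K x (Rᴴ⇒¬Solves H-sym R x)) (sym (L≡K x xᵥ))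

  module _ (y : Subset (suc n)) (Hy≡eᵥ : Solves H v y) where

    Ker∌ : ∀ x → Ker H x → x ! v ≡ false
    Ker∌ x = Ker⇒∌ H-sym x y Hy≡eᵥ

    K∌ : ∀ x → x ! v ≡ true → K x ≡ false
    K∌ x xᵥ = ¬-not λ k → true≢false (trans (sym xᵥ) (Ker∌ x (Ker?⇒Ker x k)))

    L≡K∘△ : ∀ x → x ! v ≡ true → L x ≡ K (x △ y)
    L≡K∘△ x xᵥ = Bool-ext (mk⇔
      (λ l → Ker⇒Ker? (x △ y) (Equivalence.to (Solves⇔Ker-△ H v x y Hy≡eᵥ) (Equivalence.to (L⇔Solves x xᵥ) l)))
      (λ k → Equivalence.from (L⇔Solves x xᵥ) (Equivalence.from (Solves⇔Ker-△ H v x y Hy≡eᵥ) (Ker?⇒Ker (x △ y) k))))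

  counts-P : Pᴴ H v → count L ≡ count K + count K × count (ker? (H ∖ᵥ v)) ≡ count K
  counts-P (y , Hy≡eᵥ , yᵥ) = count-L , trans count-∖ᵥ (count-cong pointwise)
    where
    L∧¬ᵥ≡K : ∀ x → L x ∧ not (x ! v) ≡ K x
    L∧¬ᵥ≡K x with x ! v in xᵥ
    ... | false = trans (∧-identityʳ (L x)) (L≡K x xᵥ)
    ... | true  = trans (∧-zeroʳ (L x)) (sym (K∌ y Hy≡eᵥ x xᵥ))

    L∧ᵥ≡K∘△ : ∀ x → L x ∧ not (not (x ! v)) ≡ K (x △ y)
    L∧ᵥ≡K∘△ x with x ! v in xᵥ
    ... | true  = trans (∧-identityʳ (L x)) (L≡K∘△ y Hy≡eᵥ x xᵥ)
    ... | false = trans (∧-zeroʳ (L x)) (sym (K∌ y Hy≡eᵥ (x △ y) (trans (flip-v x y yᵥ) (cong not xᵥ))))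

    count-L : count L ≡ count K + count K
    count-L = begin
      count L                                                                     ≡⟨ count-split L (λ x → not (x ! v)) ⟩
      count (λ x → L x ∧ not (x ! v)) + count (λ x → L x ∧ not (not (x ! v)))     ≡⟨ cong₂ _+_ (count-cong L∧¬ᵥ≡K) (count-cong L∧ᵥ≡K∘△) ⟩
      count K + count (λ x → K (x △ y))                                           ≡⟨ cong (count K +_) (count-△ K y) ⟩
      count K + count K                                                           ∎
      where open ≡-Reasoning

    pointwise : ∀ x → not (x ! v) ∧ vanishesOffV? x ≡ K x
    pointwise x with x ! v in xᵥ
    ... | true  = sym (K∌ y Hy≡eᵥ x xᵥ)
    ... | false = vanishesOffV?≡K x λ Hx≡eᵥ → true≢false
      (trans (sym (trans (flip-v x y yᵥ) (cong not xᵥ))) (Ker∌ y Hy≡eᵥ (x △ y) (Equivalence.to (Solves⇔Ker-△ H v x y Hy≡eᵥ) Hx≡eᵥ)))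

  module _ (y : Subset (suc n)) (Hy≡eᵥ : Solves H v y) (yᵥ : y ! v ≡ false) where

    △y-keeps-v : ∀ x → (x △ y) ! v ≡ x ! v
    △y-keeps-v x = trans (!-△ x y v) (trans (cong (x ! v xor_) yᵥ) (xor-identityʳ (x ! v)))

    unsolved≡K : ∀ x → (not (x ! v) ∧ vanishesOffV? x) ∧ not ((H · x) v) ≡ K x
    unsolved≡K x = Bool-ext (mk⇔ to from)
      where
      to : (not (x ! v) ∧ vanishesOffV? x) ∧ not ((H · x) v) ≡ true → K x ≡ true
      to t with Equivalence.to ∧≡true⇔ t
      ... | p , Hxᵥ = Ker⇒Ker? x (VanishesOffV⇒Ker x (Equivalence.to (vanishesOffV?≡true⇔ x) (proj₂ (Equivalence.to (∧≡true⇔ {not (x ! v)}) p)))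
                                           (Equivalence.to not≡true⇔ Hxᵥ))
      from : K x ≡ true → (not (x ! v) ∧ vanishesOffV? x) ∧ not ((H · x) v) ≡ true
      from k = Equivalence.from ∧≡true⇔ (Equivalence.from (∧≡true⇔ {not (x ! v)})
        (Equivalence.from not≡true⇔ (Ker∌ y Hy≡eᵥ x Hx≡0) , Equivalence.from (vanishesOffV?≡true⇔ x) (Ker⇒VanishesOffV x Hx≡0)) ,
        Equivalence.from not≡true⇔ (Hx≡0 v))
        where
        Hx≡0 : Ker H x
        Hx≡0 = Ker?⇒Ker x k

    solved≡K∘△ : ∀ x → (not (x ! v) ∧ vanishesOffV? x) ∧ not (not ((H · x) v)) ≡ K (x △ y)
    solved≡K∘△ x = Bool-ext (mk⇔ to from)
      where
      to : (not (x ! v) ∧ vanishesOffV? x) ∧ not (not ((H · x) v)) ≡ true → K (x △ y) ≡ true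
      to t with Equivalence.to ∧≡true⇔ t
      ... | p , Hxᵥ = Ker⇒Ker? (x △ y) (Equivalence.to (Solves⇔Ker-△ H v x y Hy≡eᵥ)
        (VanishesOffV⇒Solves x (Equivalence.to (vanishesOffV?≡true⇔ x) (proj₂ (Equivalence.to (∧≡true⇔ {not (x ! v)}) p))) (trans (sym (not-involutive _)) Hxᵥ)))
      from : K (x △ y) ≡ true → (not (x ! v) ∧ vanishesOffV? x) ∧ not (not ((H · x) v)) ≡ true
      from k = Equivalence.from ∧≡true⇔ (Equivalence.from (∧≡true⇔ {not (x ! v)})
        (Equivalence.from not≡true⇔ (trans (sym (△y-keeps-v x)) (Ker∌ y Hy≡eᵥ (x △ y) (Ker?⇒Ker (x △ y) k))) ,
         Equivalence.from (vanishesOffV?≡true⇔ x) (Solves⇒VanishesOffV x Hx≡eᵥ)) ,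
        trans (not-involutive _) (trans (Hx≡eᵥ v) (δ-refl v)))
        where
        Hx≡eᵥ : Solves H v x
        Hx≡eᵥ = Equivalence.from (Solves⇔Ker-△ H v x y Hy≡eᵥ) (Ker?⇒Ker (x △ y) k)

  counts-Q : Qᴴ H v → count L ≡ count K × count (ker? (H ∖ᵥ v)) ≡ count K + count K
  counts-Q (y , Hy≡eᵥ , yᵥ) = count-cong L≡K′ , count-D
    where
    L≡K′ : ∀ x → L x ≡ K x
    L≡K′ x with x ! v in xᵥ
    ... | false = L≡K x xᵥ
    ... | true  = trans (L≡K∘△ y Hy≡eᵥ x xᵥ)
                        (trans (K∌ y Hy≡eᵥ (x △ y) (trans (△y-keeps-v y Hy≡eᵥ yᵥ x) xᵥ)) (sym (K∌ y Hy≡eᵥ x xᵥ)))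

    count-D : count (ker? (H ∖ᵥ v)) ≡ count K + count K
    count-D = begin
      count (ker? (H ∖ᵥ v))                        ≡⟨ count-∖ᵥ ⟩
      count (λ x → not (x ! v) ∧ vanishesOffV? x)          ≡⟨ count-split (λ x → not (x ! v) ∧ vanishesOffV? x) (λ x → not ((H · x) v)) ⟩
      count (λ x → (not (x ! v) ∧ vanishesOffV? x) ∧ not ((H · x) v)) + count (λ x → (not (x ! v) ∧ vanishesOffV? x) ∧ not (not ((H · x) v)))
                                                   ≡⟨ cong₂ _+_ (count-cong (unsolved≡K y Hy≡eᵥ yᵥ)) (count-cong (solved≡K∘△ y Hy≡eᵥ yᵥ)) ⟩
      count K + count (λ x → K (x △ y))            ≡⟨ cong (count K +_) (count-△ K y) ⟩
      count K + count K                            ∎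
      where open ≡-Reasoning

  Rᴴ? : Dec (Rᴴ H v)
  Rᴴ? = Dec-map (mk⇔ (λ (x , t) → let k , xᵥ = Equivalence.to (∧≡true⇔ {K x}) t in x , Ker?⇒Ker x k , xᵥ)
                     (λ (x , Hx≡0 , xᵥ) → x , Equivalence.from ∧≡true⇔ (Ker⇒Ker? x Hx≡0 , xᵥ)))
                (anySubset? λ x → K x ∧ x ! v ≟ᴮ true)

  trichotomy : Rᴴ H v ⊎ Pᴴ H v ⊎ Qᴴ H v
  trichotomy with Rᴴ?
  ... | yes R = inj₁ R
  ... | no ¬R with fredholm H ⁅ v ⁆ eᵥ⊥ker
    where
    eᵥ⊥ker : ∀ y → Ker (transpose H) y → y • ⁅ v ⁆ ≡ false
    eᵥ⊥ker y Hᵀy≡0 = trans (Σ₂-cong λ i → trans (∧-comm (y ! i) (⁅ v ⁆ ! i)) (cong (_∧ y ! i) (!-⁅⁆ v i)))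
                           (trans (Σ₂-δ v (y !_)) (¬-not λ yᵥ → ¬R (y , Hy≡0 , yᵥ)))
      where
      Hy≡0 : Ker H y
      Hy≡0 i = trans (Σ₂-cong λ j → cong (_∧ y ! j) (H-sym i j)) (Hᵀy≡0 i)
  ...   | x , Hx≡eᵥ with x ! v in xᵥ
  ...     | true  = inj₂ (inj₁ (x , (λ i → trans (Hx≡eᵥ i) (!-⁅⁆ v i)) , xᵥ))
  ...     | false = inj₂ (inj₂ (x , (λ i → trans (Hx≡eᵥ i) (!-⁅⁆ v i)) , xᵥ))

  private
    count-K : count K ≡ 2 ^ ν H
    count-K = count-ker≡2^[n∸rank] H

    count-L : count L ≡ 2 ^ ν (H +ₗ ⁅ v ⁆)
    count-L = count-ker≡2^[n∸rank] (H +ₗ ⁅ v ⁆)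

    count-D : count (ker? (H ∖ᵥ v)) ≡ 2 ^ ν (H ∖ᵥ v)
    count-D = count-ker≡2^[n∸rank] (H ∖ᵥ v)

    exponent-≡ : ∀ {p q x y} → p ≡ q → p ≡ 2 ^ x → q ≡ 2 ^ y → x ≡ y
    exponent-≡ {x = x} {y} p≡q p≡2^x q≡2^y = 2^-injective x y (trans (sym p≡2^x) (trans p≡q q≡2^y))

    exponent-suc : ∀ {p q x y} → p ≡ q + q → p ≡ 2 ^ x → q ≡ 2 ^ y → x ≡ suc y
    exponent-suc {x = x} {y} p≡2q p≡2^x q≡2^y =
      2^-injective x (suc y) (trans (sym p≡2^x) (trans p≡2q (trans (cong₂ _+_ q≡2^y q≡2^y) (cong (2 ^ y +_) (sym (+-identityʳ (2 ^ y)))))))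

  nullities-R : Rᴴ H v → ν H ≡ suc (ν (H +ₗ ⁅ v ⁆)) × ν (H ∖ᵥ v) ≡ ν (H +ₗ ⁅ v ⁆)
  nullities-R R = let K≡2L , D≡L = counts-R R in exponent-suc K≡2L count-K count-L , exponent-≡ D≡L count-D count-L

  nullities-P : Pᴴ H v → ν (H +ₗ ⁅ v ⁆) ≡ suc (ν H) × ν (H ∖ᵥ v) ≡ ν H
  nullities-P P = let L≡2K , D≡K = counts-P P in exponent-suc L≡2K count-L count-K , exponent-≡ D≡K count-D count-K

  nullities-Q : Qᴴ H v → ν (H ∖ᵥ v) ≡ suc (ν H) × ν (H +ₗ ⁅ v ⁆) ≡ ν H
  nullities-Q Q = let L≡K , D≡2K = counts-Q Q in exponent-suc D≡2K count-D count-K , exponent-≡ L≡K count-L count-K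

  private
    Above : ℕ → Set
    Above x = nmax H v ≡ suc x

    ¬Above : ∀ {x} → nmax H v ≡ x → ¬ Above x
    ¬Above nmax≡x nmax≡1+x = 1+n≢n (trans (sym nmax≡1+x) nmax≡x)

    ⊔-first : ∀ c → (suc c ⊔ c) ⊔ c ≡ suc c
    ⊔-first zero    = refl
    ⊔-first (suc c) = cong suc (⊔-first c)

    ⊔-second : ∀ a → (a ⊔ suc a) ⊔ a ≡ suc a
    ⊔-second zero    = refl
    ⊔-second (suc a) = cong suc (⊔-second a)

    ⊔-third : ∀ a → (a ⊔ a) ⊔ suc a ≡ suc a
    ⊔-third zero    = refl
    ⊔-third (suc a) = cong suc (⊔-third a)

  nmax-R : Rᴴ H v → nmax H v ≡ ν H × Above (ν (H ∖ᵥ v)) × Above (ν (H +ₗ ⁅ v ⁆))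
  nmax-R R = nmax≡a , trans nmax≡a (trans a≡1+c (cong suc (sym b≡c))) , trans nmax≡a a≡1+c
    where
    a≡1+c : ν H ≡ suc (ν (H +ₗ ⁅ v ⁆))
    a≡1+c = proj₁ (nullities-R R)
    b≡c : ν (H ∖ᵥ v) ≡ ν (H +ₗ ⁅ v ⁆)
    b≡c = proj₂ (nullities-R R)
    nmax≡a : nmax H v ≡ ν H
    nmax≡a = trans (cong₂ (λ a b → (a ⊔ b) ⊔ ν (H +ₗ ⁅ v ⁆)) a≡1+c b≡c) (trans (⊔-first _) (sym a≡1+c))

  nmax-P : Pᴴ H v → nmax H v ≡ ν (H +ₗ ⁅ v ⁆) × Above (ν H) × Above (ν (H ∖ᵥ v))
  nmax-P P = nmax≡c , trans nmax≡c c≡1+a , trans nmax≡c (trans c≡1+a (cong suc (sym b≡a)))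
    where
    c≡1+a : ν (H +ₗ ⁅ v ⁆) ≡ suc (ν H)
    c≡1+a = proj₁ (nullities-P P)
    b≡a : ν (H ∖ᵥ v) ≡ ν H
    b≡a = proj₂ (nullities-P P)
    nmax≡c : nmax H v ≡ ν (H +ₗ ⁅ v ⁆)
    nmax≡c = trans (cong₂ (λ b c → (ν H ⊔ b) ⊔ c) b≡a c≡1+a) (trans (⊔-third _) (sym c≡1+a))

  nmax-Q : Qᴴ H v → nmax H v ≡ ν (H ∖ᵥ v) × Above (ν H) × Above (ν (H +ₗ ⁅ v ⁆))
  nmax-Q Q = nmax≡b , trans nmax≡b b≡1+a , trans nmax≡b (trans b≡1+a (cong suc (sym c≡a)))
    where
    b≡1+a : ν (H ∖ᵥ v) ≡ suc (ν H)
    b≡1+a = proj₁ (nullities-Q Q)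
    c≡a : ν (H +ₗ ⁅ v ⁆) ≡ ν H
    c≡a = proj₂ (nullities-Q Q)
    nmax≡b : nmax H v ≡ ν (H ∖ᵥ v)
    nmax≡b = trans (cong₂ (λ b c → (ν H ⊔ b) ⊔ c) b≡1+a c≡a) (trans (⊔-second _) (sym b≡1+a))

  nmax-characterisation : (Rᴴ H v ⇔ nmax H v ≡ ν H) × (Pᴴ H v ⇔ nmax H v ≡ ν (H +ₗ ⁅ v ⁆)) × (Qᴴ H v ⇔ nmax H v ≡ ν (H ∖ᵥ v))
  nmax-characterisation = mk⇔ (proj₁ ∘ nmax-R) from-R , mk⇔ (proj₁ ∘ nmax-P) from-P , mk⇔ (proj₁ ∘ nmax-Q) from-Q
    where
    from-R : nmax H v ≡ ν H → Rᴴ H v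
    from-R e with trichotomy
    ... | inj₁ R        = R
    ... | inj₂ (inj₁ P) = ⊥-elim (¬Above e (proj₁ (proj₂ (nmax-P P))))
    ... | inj₂ (inj₂ Q) = ⊥-elim (¬Above e (proj₁ (proj₂ (nmax-Q Q))))
    from-P : nmax H v ≡ ν (H +ₗ ⁅ v ⁆) → Pᴴ H v
    from-P e with trichotomy
    ... | inj₁ R        = ⊥-elim (¬Above e (proj₂ (proj₂ (nmax-R R))))
    ... | inj₂ (inj₁ P) = P
    ... | inj₂ (inj₂ Q) = ⊥-elim (¬Above e (proj₂ (proj₂ (nmax-Q Q))))
    from-Q : nmax H v ≡ ν (H ∖ᵥ v) → Qᴴ H v
    from-Q e with trichotomy
    ... | inj₁ R        = ⊥-elim (¬Above e (proj₁ (proj₂ (nmax-R R))))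
    ... | inj₂ (inj₁ P) = ⊥-elim (¬Above e (proj₂ (proj₂ (nmax-P P))))
    ... | inj₂ (inj₂ Q) = Q

-- Binary matroids and their fundamental graphs

module Representation {r} (M : SetSystem n) (A : Matrix r n) (M⇔A : ∀ X → M X ⇔ ColBasis A X)
                      (Z : Subset n) (MZ : M Z) where

  Z-indep : LinIndep A Z
  Z-indep = proj₁ (Equivalence.to (ColBasis⇔ A Z) (Equivalence.to (M⇔A Z) MZ))

  Z-maximal : Maximal A Z
  Z-maximal = proj₂ (Equivalence.to (ColBasis⇔ A Z) (Equivalence.to (M⇔A Z) MZ))

  open MaximalIndependent A Z Z-indep Z-maximal public

  Independent⇔LinIndep : ∀ Y → Independent M Y ⇔ LinIndep A Y
  Independent⇔LinIndep Y = mk⇔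
    (λ (B , MB , Y⊆B) → LinIndep-⊆ {A = A} {B} {Y} (proj₁ (Equivalence.to (ColBasis⇔ A B) (Equivalence.to (M⇔A B) MB))) (⊆⇒⊆ᵇ Y⊆B))
    (λ indep → let B , B-basis , Y⊆B = Greedy.extend-to-basis A Y indep in B , Equivalence.from (M⇔A B) B-basis , λ {x} → ⊆ᵇ⇒⊆ {X = Y} {B} Y⊆B {x})

  fundamental : Fin n → Subset n
  fundamental j = column j △ ⁅ j ⁆

  column∌ : ∀ {i} j → Z ! i ≡ false → column j ! i ≡ false
  column∌ {i} j Zi = ⊆ᵇ-elim {Y = column j} {Z} (column⊆S j) i Zi

  fundamental-≢ : ∀ j {i} → i ≢ j → fundamental j ! i ≡ column j ! i
  fundamental-≢ j = △⁅⁆-≢ (column j)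

  fundamental-∋ : ∀ j → Z ! j ≡ false → fundamental j ! j ≡ true
  fundamental-∋ j Zj = trans (△⁅⁆-self (column j) j) (cong not (column∌ j Zj))

  fundamental-ker : ∀ j → Z ! j ≡ false → Ker A (fundamental j)
  fundamental-ker j Zj i = trans (·-△ A (column j) ⁅ j ⁆ i) (≡⇒xor≡false (trans (·-column j Zj i) (sym (·-⁅⁆ A j i))))

  fundamental-dep : ∀ j {X} → Z ! j ≡ false → fundamental j ⊆ᵇ X → LinDep A X
  fundamental-dep j Zj f⊆X = fundamental j , f⊆X , fundamental-ker j Zj , j , fundamental-∋ j Zj

  module Exchange {z j : Fin n} (Zz : Z ! z ≡ true) (Zj : Z ! j ≡ false) where

    z≢j : z ≢ j
    z≢j z≡j = true≢false (trans (sym Zz) (trans (cong (Z !_) z≡j) Zj))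

    B : Subset n
    B = (Z △ ⁅ z ⁆) △ ⁅ j ⁆

    B-z : B ! z ≡ false
    B-z = trans (△⁅⁆-≢ (Z △ ⁅ z ⁆) z≢j) (trans (△⁅⁆-self Z z) (cong not Zz))

    B-j : B ! j ≡ true
    B-j = trans (△⁅⁆-self (Z △ ⁅ z ⁆) j) (cong not (trans (△⁅⁆-≢ Z (z≢j ∘ sym)) Zj))

    B-other : ∀ {i} → i ≢ z → i ≢ j → B ! i ≡ Z ! i
    B-other i≢z i≢j = trans (△⁅⁆-≢ (Z △ ⁅ z ⁆) i≢j) (△⁅⁆-≢ Z i≢z)

    B⇒Z : ∀ i → B ! i ≡ true → i ≢ j → Z ! i ≡ true
    B⇒Z i Bi i≢j with i ≟ z
    ... | yes refl = ⊥-elim (true≢false (trans (sym Bi) B-z))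
    ... | no  i≢z  = trans (sym (B-other i≢z i≢j)) Bi

    Z⇒B : ∀ i → Z ! i ≡ true → i ≢ z → B ! i ≡ true
    Z⇒B i Zi i≢z with i ≟ j
    ... | yes refl = B-j
    ... | no  i≢j  = trans (B-other i≢z i≢j) Zi

    ∣B∣≡rank : ∣ B ∣ ≡ rank A
    ∣B∣≡rank = trans (∣△⁅⁆∣-∉ (Z △ ⁅ z ⁆) j (trans (△⁅⁆-≢ Z (z≢j ∘ sym)) Zj))
                     (trans (∣△⁅⁆∣-∈ Z z Zz) (Maximal⇒∣∣≡rank A Z Z-indep Z-maximal))

    B-indep : column j ! z ≡ true → LinIndep A B
    B-indep cz U U⊆B AU≡0 with U ! j in Uj
    ... | false = Z-indep U U⊆Z AU≡0
      where
      U⊆Z : U ⊆ᵇ Z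
      U⊆Z i Ui = B⇒Z i (U⊆B i Ui) λ { refl → true≢false (trans (sym Ui) Uj) }
    ... | true  = ⊥-elim (true≢false (trans (sym Uz) (⊆ᵇ-elim {Y = U} {B} U⊆B z B-z)))
      where
      U′ : Subset n
      U′ = U △ ⁅ j ⁆
      U′⊆Z : U′ ⊆ᵇ Z
      U′⊆Z i U′i with i ≟ j
      ... | yes refl = ⊥-elim (true≢false (trans (sym U′i) (trans (△⁅⁆-self U i) (cong not Uj))))
      ... | no  i≢j  = B⇒Z i (U⊆B i (trans (sym (△⁅⁆-≢ U i≢j)) U′i)) i≢j
      AU′≡Aj : ∀ i → (A · U′) i ≡ (A · column j) i
      AU′≡Aj i = trans (·-△ A U ⁅ j ⁆ i) (trans (cong (_xor (A · ⁅ j ⁆) i) (AU≡0 i))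
                       (trans (·-⁅⁆ A j i) (sym (·-column j Zj i))))
      Uz : U ! z ≡ true
      Uz = trans (sym (△⁅⁆-≢ U z≢j)) (trans (LinIndep-unique A {Z} Z-indep U′ (column j) U′⊆Z (column⊆S j) AU′≡Aj z) cz)

    exchange : ColBasis A B ⇔ column j ! z ≡ true
    exchange = mk⇔
      (λ B-basis → ¬-not λ cz → LinIndep⇒¬LinDep {A = A} {B} (proj₁ (Equivalence.to (ColBasis⇔ A B) B-basis))
                                  (fundamental-dep j {B} Zj (fundamental⊆B cz)))
      (λ cz → Equivalence.from (ColBasis⇔ A B) (B-indep cz , LinIndep∧rank⇒Maximal A B (B-indep cz) ∣B∣≡rank))
      where
      fundamental⊆B : column j ! z ≡ false → fundamental j ⊆ᵇ B
      fundamental⊆B cz i fi with i ≟ j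
      ... | yes refl = B-j
      ... | no  i≢j  = Z⇒B i (column⊆S j i ci) λ { refl → true≢false (trans (sym ci) cz) }
        where
        ci : column j ! i ≡ true
        ci = trans (sym (fundamental-≢ j i≢j)) fi

  circuit⇒Ker : ∀ C → Circuit M C → Ker A C
  circuit⇒Ker C (¬indep , minimal) with LinIndep⊎LinDep A C
  ... | inj₁ indep = ⊥-elim (¬indep (Equivalence.from (Independent⇔LinIndep C) indep))
  ... | inj₂ (U , U⊆C , AU≡0 , k , Uk) = subst (Ker A) (≗⇒≡ {x = U} {C} U≗C) AU≡0
    where
    U≗C : ∀ i → U ! i ≡ C ! i
    U≗C i with C ! i in Ci
    ... | false = ⊆ᵇ-elim {Y = U} {C} U⊆C i Ci
    ... | true  = ¬-not λ Ui → true≢false (trans (sym Uk) (Equivalence.to (Independent⇔LinIndep U) (minimal U (U⊂C Ui)) U (λ _ e → e) AU≡0 k))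
      where
      U⊂C : U ! i ≡ false → U ⊂ C
      U⊂C Ui = (λ {x} → ⊆ᵇ⇒⊆ {X = U} {C} U⊆C {x}) , i , lookup⇒[]= i C Ci , ≡false⇒∉ Ui

  CS⇒Ker : ∀ X → CS M X → Ker A X
  CS⇒Ker X (cs , circuits , Σcs≡X) = subst (Ker A) Σcs≡X (sum cs circuits)
    where
    sum : ∀ cs → All (Circuit M) cs → Ker A (foldr _△_ ⊥ cs)
    sum []       []               i = ·-⊥ A i
    sum (C ∷ cs) (C-circ ∷ circs) i = trans (·-△ A C (foldr _△_ ⊥ cs) i) (cong₂ _xor_ (circuit⇒Ker C C-circ i) (sum cs circs i))

  CS-combination : ∀ {k} (c : Fin k → Bool) (V : Fin k → Subset n) → (∀ j → c j ≡ true → Circuit M (V j)) →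
                   CS M (combination c V)
  CS-combination {zero} c V _ = [] , [] , ≗⇒≡ λ i → trans (!-⊥ i) (sym (!-tabulate _ i))
  CS-combination {suc k} c V circ = by-head (c zero) refl
    where
    rest : Subset n
    rest = combination (c ∘ suc) (V ∘ suc)
    CS-rest : CS M rest
    CS-rest = CS-combination (c ∘ suc) (V ∘ suc) (circ ∘ suc)
    head : ∀ {b} → c zero ≡ b → ∀ i → combination c V ! i ≡ (b ∧ V zero ! i) xor rest ! i
    head c₀ i = trans (!-tabulate _ i) (cong₂ (λ b r → (b ∧ V zero ! i) xor r) c₀ (sym (!-tabulate _ i)))
    by-head : ∀ b → c zero ≡ b → CS M (combination c V)
    by-head false c₀ = subst (CS M) (≗⇒≡ λ i → sym (head c₀ i)) CS-rest
    by-head true  c₀ with CS-rest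
    ... | cs , circs , Σcs≡rest = V zero ∷ cs , circ zero c₀ ∷ circs ,
      ≗⇒≡ λ i → trans (!-△ (V zero) _ i) (trans (cong (λ r → V zero ! i xor r ! i) Σcs≡rest) (sym (head c₀ i)))

  fundamental-circuit : ∀ j → Z ! j ≡ false → Circuit M (fundamental j)
  fundamental-circuit j Zj = dependent , minimal
    where
    dependent : ¬ Independent M (fundamental j)
    dependent indep = LinIndep⇒¬LinDep {A = A} {fundamental j} (Equivalence.to (Independent⇔LinIndep _) indep)
                                       (fundamental-dep j {fundamental j} Zj (λ _ e → e))
    minimal : ∀ Y → Y ⊂ fundamental j → Independent M Y
    minimal Y (Y⊆f , x , x∈f , x∉Y) with x ≟ j
    ... | yes refl = Z , MZ , λ {i} → ⊆ᵇ⇒⊆ {X = Y} {Z} Y⊆Z {i}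
      where
      Y⊆Z : Y ⊆ᵇ Z
      Y⊆Z i Yi with i ≟ x
      ... | yes refl = ⊥-elim (x∉Y (lookup⇒[]= i Y Yi))
      ... | no  i≢x  = column⊆S x i (trans (sym (fundamental-≢ x i≢x)) (⊆⇒⊆ᵇ {X = Y} {fundamental x} Y⊆f i Yi))
    ... | no  x≢j  = B , Equivalence.from (M⇔A B) (Equivalence.from exchange cx) , λ {i} → ⊆ᵇ⇒⊆ {X = Y} {B} Y⊆B {i}
      where
      cx : column j ! x ≡ true
      cx = trans (sym (fundamental-≢ j x≢j)) ([]=⇒lookup x∈f)
      open Exchange (column⊆S j x cx) Zj
      Y⊆B : Y ⊆ᵇ B
      Y⊆B i Yi with i ≟ j
      ... | yes refl = B-j
      ... | no  i≢j  = Z⇒B i (column⊆S j i (trans (sym (fundamental-≢ j i≢j)) (⊆⇒⊆ᵇ {X = Y} {fundamental j} Y⊆f i Yi)))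
                           λ { refl → x∉Y (lookup⇒[]= i Y Yi) }

  combination-fundamental : ∀ y i → combination (y !_) fundamental ! i ≡ lift y ! i xor y ! i
  combination-fundamental y i = begin
    combination (y !_) fundamental ! i                                         ≡⟨ !-tabulate _ i ⟩
    Σ₂ (λ j → y ! j ∧ fundamental j ! i)                                       ≡⟨ Σ₂-cong (λ j → trans (cong (y ! j ∧_) (!-△ (column j) ⁅ j ⁆ i)) (∧-distribˡ-xor (y ! j) _ _)) ⟩
    Σ₂ (λ j → (y ! j ∧ column j ! i) xor (y ! j ∧ ⁅ j ⁆ ! i))                  ≡⟨ Σ₂-xor (λ j → y ! j ∧ column j ! i) _ ⟩
    Σ₂ (λ j → y ! j ∧ column j ! i) xor Σ₂ (λ j → y ! j ∧ ⁅ j ⁆ ! i)          ≡⟨ cong₂ _xor_ (sym (!-tabulate _ i)) sifted ⟩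
    lift y ! i xor y ! i                                                       ∎
    where
    open ≡-Reasoning
    sifted : Σ₂ (λ j → y ! j ∧ ⁅ j ⁆ ! i) ≡ y ! i
    sifted = trans (Σ₂-cong λ j → trans (∧-comm (y ! j) (⁅ j ⁆ ! i)) (cong (_∧ y ! j) (trans (!-⁅⁆ j i) (δ-sym i j)))) (Σ₂-δ i (y !_))

  Ker⇒decomposed : ∀ X → Ker A X → X ≡ combination ((X ∩ ∁ Z) !_) fundamental
  Ker⇒decomposed X AX≡0 = ≗⇒≡ λ i → begin
    X ! i                                       ≡⟨ xor-moveʳ (!-△ X (lift (X ∩ ∁ Z)) i) ⟩
    shear X ! i xor lift (X ∩ ∁ Z) ! i          ≡⟨ cong (_xor lift (X ∩ ∁ Z) ! i) (shear-off-Z i) ⟩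
    (X ∩ ∁ Z) ! i xor lift (X ∩ ∁ Z) ! i        ≡⟨ xor-comm ((X ∩ ∁ Z) ! i) (lift (X ∩ ∁ Z) ! i) ⟩
    lift (X ∩ ∁ Z) ! i xor (X ∩ ∁ Z) ! i        ≡⟨ combination-fundamental (X ∩ ∁ Z) i ⟨
    combination ((X ∩ ∁ Z) !_) fundamental ! i  ∎
    where
    open ≡-Reasoning
    shear-off-Z : ∀ i → shear X ! i ≡ (X ∩ ∁ Z) ! i
    shear-off-Z i = trans (cong (_! i) (∩-∁-split Z (shear X)))
                          (trans (!-△ (shear X ∩ Z) (shear X ∩ ∁ Z) i)
                                 (cong₂ _xor_ (Equivalence.to (Ker⇔shear∩S≡∅ X) AX≡0 i) (cong (_! i) (shear-∩∁ X))))

  ∩∁-∋⇒∉ : ∀ (X : Subset n) j → (X ∩ ∁ Z) ! j ≡ true → Z ! j ≡ false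
  ∩∁-∋⇒∉ X j e = Equivalence.to not≡true⇔ (∧-conicalʳ (X ! j) _ (trans (sym (!-∩∁ X Z j)) e))

  CS⇔Ker : ∀ X → CS M X ⇔ Ker A X
  CS⇔Ker X = mk⇔ (CS⇒Ker X) λ AX≡0 → subst (CS M) (sym (Ker⇒decomposed X AX≡0))
    (CS-combination ((X ∩ ∁ Z) !_) fundamental λ j e → fundamental-circuit j (∩∁-∋⇒∉ X j e))

principal : Graph n → Subset n → Matrix n n
principal G X i j = X ! i ∧ G i j

principal-· : (G : Graph n) (X U : Subset n) (i : Fin n) → (principal G X · U) i ≡ X ! i ∧ (G · U) i
principal-· G X U i = trans (Σ₂-cong λ j → ∧-assoc (X ! i) (G i j) (U ! j)) (Σ₂-∧ˡ (X ! i) λ j → G i j ∧ U ! j)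

graphMatroid⇔ : (G : Graph n) (X : Subset n) → graphMatroid G X ⇔ LinIndep (principal G X) X
graphMatroid⇔ G X = mk⇔ (Equivalence.to (colIndep?≡true⇔ (principal G X) X) ∘ Equivalence.to T-≡)
                        (Equivalence.from T-≡ ∘ Equivalence.from (colIndep?≡true⇔ (principal G X) X))

·-on-⁅⁆ : (G : Graph n) (u : Fin n) (U : Subset n) → U ⊆ᵇ ⁅ u ⁆ → ∀ i → (G · U) i ≡ G i u ∧ U ! u
·-on-⁅⁆ G u U U⊆u i = trans (Σ₂-cong λ j → cong (G i j ∧_) (support j))
                            (trans (Σ₂-cong λ j → ∧-left-comm (G i j) (δ j u) (U ! u)) (Σ₂-δ u λ j → G i j ∧ U ! u))
  where
  support : ∀ j → U ! j ≡ δ j u ∧ U ! u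
  support j with j ≟ u
  ... | yes refl = refl
  ... | no  j≢u  = ⊆ᵇ-elim {Y = U} {⁅ u ⁆} U⊆u j (⁅⁆-≢ j≢u)

singleton-nonsingular : (G : Graph n) (u : Fin n) → G u u ≡ true → LinIndep (principal G ⁅ u ⁆) ⁅ u ⁆
singleton-nonsingular G u Guu U U⊆u PU≡0 k with k ≟ u
... | no  k≢u  = ⊆ᵇ-elim {Y = U} {⁅ u ⁆} U⊆u k (⁅⁆-≢ k≢u)
... | yes refl = begin
  U ! k                               ≡⟨ cong (_∧ U ! k) Guu ⟨
  G k k ∧ U ! k                       ≡⟨ ·-on-⁅⁆ G k U U⊆u k ⟨
  (G · U) k                           ≡⟨ cong (_∧ (G · U) k) (⁅⁆-self k) ⟨
  ⁅ k ⁆ ! k ∧ (G · U) k               ≡⟨ principal-· G ⁅ k ⁆ U k ⟨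
  (principal G ⁅ k ⁆ · U) k           ≡⟨ PU≡0 k ⟩
  false                               ∎
  where open ≡-Reasoning

module Pair (G : Graph n) (G-sym : Symmetric G) {u w : Fin n} (u≢w : u ≢ w) (Guu : G u u ≡ false) (Gww : G w w ≡ false) where

  P : Subset n
  P = ⁅ u ⁆ ∪ ⁅ w ⁆

  P-u : P ! u ≡ true
  P-u = trans (!-∪ ⁅ u ⁆ ⁅ w ⁆ u) (cong (_∨ ⁅ w ⁆ ! u) (⁅⁆-self u))

  P-w : P ! w ≡ true
  P-w = ∪⁅⁆-self ⁅ u ⁆ w

  P-other : ∀ {i} → i ≢ u → i ≢ w → P ! i ≡ false
  P-other i≢u i≢w = trans (∪⁅⁆-≢ ⁅ u ⁆ i≢w) (⁅⁆-≢ i≢u)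

  ·-on-P : ∀ U → U ⊆ᵇ P → ∀ i → (G · U) i ≡ (G i u ∧ U ! u) xor (G i w ∧ U ! w)
  ·-on-P U U⊆P i = begin
    Σ₂ (λ j → G i j ∧ U ! j)                                                  ≡⟨ Σ₂-cong (λ j → cong (G i j ∧_) (support j)) ⟩
    Σ₂ (λ j → G i j ∧ ((δ j u ∧ U ! u) xor (δ j w ∧ U ! w)))                  ≡⟨ Σ₂-cong (λ j → distribute (G i j) (δ j u) (U ! u) (δ j w) (U ! w)) ⟩
    Σ₂ (λ j → (δ j u ∧ (G i j ∧ U ! u)) xor (δ j w ∧ (G i j ∧ U ! w)))       ≡⟨ Σ₂-xor (λ j → δ j u ∧ (G i j ∧ U ! u)) _ ⟩
    Σ₂ (λ j → δ j u ∧ (G i j ∧ U ! u)) xor Σ₂ (λ j → δ j w ∧ (G i j ∧ U ! w)) ≡⟨ cong₂ _xor_ (Σ₂-δ u λ j → G i j ∧ U ! u) (Σ₂-δ w λ j → G i j ∧ U ! w) ⟩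
    (G i u ∧ U ! u) xor (G i w ∧ U ! w)                                       ∎
    where
    open ≡-Reasoning
    distribute : ∀ g d a e b → g ∧ ((d ∧ a) xor (e ∧ b)) ≡ (d ∧ (g ∧ a)) xor (e ∧ (g ∧ b))
    distribute = solve-∀ GF2
    support : ∀ j → U ! j ≡ (δ j u ∧ U ! u) xor (δ j w ∧ U ! w)
    support j with j ≟ u
    ... | yes refl = sym (trans (cong (λ d → U ! j xor (d ∧ U ! w)) (δ-≢ u≢w)) (xor-identityʳ (U ! j)))
    ... | no  j≢u with j ≟ w
    ...   | yes refl = refl
    ...   | no  j≢w  = ⊆ᵇ-elim {Y = U} {P} U⊆P j (P-other j≢u j≢w)

  nonsingular : G u w ≡ true → LinIndep (principal G P) P
  nonsingular Guw U U⊆P PU≡0 = U≡0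
    where
    G·U≡0 : ∀ {i} → P ! i ≡ true → (G · U) i ≡ false
    G·U≡0 {i} Pi = trans (sym (cong (_∧ (G · U) i) Pi)) (trans (sym (principal-· G P U i)) (PU≡0 i))
    Uw : U ! w ≡ false
    Uw = trans (sym (trans (·-on-P U U⊆P u) (cong₂ (λ a b → (a ∧ U ! u) xor (b ∧ U ! w)) Guu Guw))) (G·U≡0 P-u)
    Uu : U ! u ≡ false
    Uu = trans (sym (trans (·-on-P U U⊆P w) (trans (cong₂ (λ a b → (a ∧ U ! u) xor (b ∧ U ! w)) (trans (G-sym w u) Guw) Gww) (xor-identityʳ (U ! u))))) (G·U≡0 P-w)
    U≡0 : ∀ k → U ! k ≡ false
    U≡0 k with k ≟ u | k ≟ w
    ... | yes refl | _        = Uu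
    ... | no  _    | yes refl = Uw
    ... | no  k≢u  | no  k≢w  = ⊆ᵇ-elim {Y = U} {P} U⊆P k (P-other k≢u k≢w)

  singular : G u w ≡ false → LinDep (principal G P) P
  singular Guw = ⁅ u ⁆ , ⁅u⁆⊆P , P·⁅u⁆≡0 , u , ⁅⁆-self u
    where
    ⁅u⁆⊆P : ⁅ u ⁆ ⊆ᵇ P
    ⁅u⁆⊆P i ui = trans (!-∪ ⁅ u ⁆ ⁅ w ⁆ i) (cong (_∨ ⁅ w ⁆ ! i) ui)
    P·⁅u⁆≡0 : Ker (principal G P) ⁅ u ⁆
    P·⁅u⁆≡0 i = trans (·-⁅⁆ (principal G P) u i) (vanishes i)
      where
      vanishes : ∀ i → P ! i ∧ G i u ≡ false
      vanishes i with i ≟ u | i ≟ w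
      ... | yes refl | _        = trans (cong (P ! i ∧_) Guu) (∧-zeroʳ _)
      ... | no  _    | yes refl = trans (cong (P ! i ∧_) (trans (G-sym i u) Guw)) (∧-zeroʳ _)
      ... | no  i≢u  | no  i≢w  = cong (_∧ G i u) (P-other i≢u i≢w)

  P-cases : ∀ {i} → P ! i ≡ true → i ≡ u ⊎ i ≡ w
  P-cases {i} Pi with i ≟ u | i ≟ w
  ... | yes i≡u | _       = inj₁ i≡u
  ... | no  _   | yes i≡w = inj₂ i≡w
  ... | no  i≢u | no  i≢w = ⊥-elim (true≢false (trans (sym Pi) (P-other i≢u i≢w)))

module FundamentalGraph {r} (M : SetSystem n) (A : Matrix r n) (M⇔A : ∀ X → M X ⇔ ColBasis A X) (Z : Subset n) (MZ : M Z)
                        (G : Graph n) (G-sym : Symmetric G) (G⇔ : ∀ X → graphMatroid G X ⇔ (M * Z) X) where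

  open Representation M A M⇔A Z MZ

  nonsingular⇔basis : ∀ X → LinIndep (principal G X) X ⇔ ColBasis A (X △ Z)
  nonsingular⇔basis X = mk⇔
    (λ indep → let Y , MY , X≡Y△Z = Equivalence.to (G⇔ X) (Equivalence.from (graphMatroid⇔ G X) indep) in
               subst (ColBasis A) (sym (trans (cong (_△ Z) X≡Y△Z) (△-cancelʳ Y Z))) (Equivalence.to (M⇔A Y) MY))
    (λ basis → Equivalence.to (graphMatroid⇔ G X)
                 (Equivalence.from (G⇔ X) (X △ Z , Equivalence.from (M⇔A (X △ Z)) basis , sym (△-cancelʳ X Z))))

  inside-singular : ∀ X u → X ⊆ᵇ Z → X ! u ≡ true → ¬ LinIndep (principal G X) X
  inside-singular X u X⊆Z Xu indep = true≢false (trans (sym (Z⊆B u (X⊆Z u Xu))) Bu)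
    where
    B-basis : LinIndep A (X △ Z) × Maximal A (X △ Z)
    B-basis = Equivalence.to (ColBasis⇔ A (X △ Z)) (Equivalence.to (nonsingular⇔basis X) indep)
    B⊆Z : (X △ Z) ⊆ᵇ Z
    B⊆Z = ⊆ᵇ-intro {Y = X △ Z} {Z} λ i Zi →
      trans (!-△ X Z i) (cong₂ _xor_ (⊆ᵇ-elim {Y = X} {Z} X⊆Z i Zi) Zi)
    Z⊆B : Z ⊆ᵇ (X △ Z)
    Z⊆B = Maximal⇒⊇ A {X △ Z} {Z} (proj₂ B-basis) Z-indep B⊆Z
    Bu : (X △ Z) ! u ≡ false
    Bu = trans (!-△ X Z u) (cong₂ _xor_ Xu (X⊆Z u Xu))

  outside-singular : ∀ X u → (∀ i → X ! i ≡ true → Z ! i ≡ false) → X ! u ≡ true → ¬ LinIndep (principal G X) X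
  outside-singular X u X∩Z≡∅ Xu indep =
    LinIndep⇒¬LinDep {A = A} {Z ∪ ⁅ u ⁆} (LinIndep-⊆ {A = A} {X △ Z} {Z ∪ ⁅ u ⁆} B-indep Z∪u⊆B) (Z-maximal u (X∩Z≡∅ u Xu))
    where
    B-indep : LinIndep A (X △ Z)
    B-indep = proj₁ (Equivalence.to (ColBasis⇔ A (X △ Z)) (Equivalence.to (nonsingular⇔basis X) indep))
    Z∪u⊆B : (Z ∪ ⁅ u ⁆) ⊆ᵇ (X △ Z)
    Z∪u⊆B i e with i ≟ u
    ... | yes refl = trans (!-△ X Z i) (cong₂ _xor_ Xu (X∩Z≡∅ i Xu))
    ... | no  i≢u  = trans (!-△ X Z i) (cong₂ _xor_ (¬-not λ Xi → true≢false (trans (sym Zi) (X∩Z≡∅ i Xi))) Zi)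
      where
      Zi : Z ! i ≡ true
      Zi = trans (sym (∪⁅⁆-≢ Z i≢u)) e

  G-loopless : ∀ u → G u u ≡ false
  G-loopless u = ¬-not λ Guu → by-side (Z ! u) refl (singleton-nonsingular G u Guu)
    where
    ⁅u⁆∋⇒≡ : ∀ i → ⁅ u ⁆ ! i ≡ true → i ≡ u
    ⁅u⁆∋⇒≡ i e with i ≟ u
    ... | yes i≡u = i≡u
    ... | no  i≢u = ⊥-elim (true≢false (trans (sym e) (⁅⁆-≢ i≢u)))
    by-side : ∀ s → Z ! u ≡ s → ¬ LinIndep (principal G ⁅ u ⁆) ⁅ u ⁆
    by-side true  Zu = inside-singular ⁅ u ⁆ u (λ i e → trans (cong (Z !_) (⁅u⁆∋⇒≡ i e)) Zu) (⁅⁆-self u)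
    by-side false Zu = outside-singular ⁅ u ⁆ u (λ i e → trans (cong (Z !_) (⁅u⁆∋⇒≡ i e)) Zu) (⁅⁆-self u)

  G-same : ∀ u w → Z ! u ≡ Z ! w → G u w ≡ false
  G-same u w Zu≡Zw with u ≟ w
  ... | yes refl = G-loopless u
  ... | no  u≢w  = ¬-not λ Guw → by-side (Z ! u) refl (nonsingular Guw)
    where
    open Pair G G-sym u≢w (G-loopless u) (G-loopless w)
    on-side : ∀ {s} → Z ! u ≡ s → ∀ i → P ! i ≡ true → Z ! i ≡ s
    on-side Zu i Pi with P-cases Pi
    ... | inj₁ refl = Zu
    ... | inj₂ refl = trans (sym Zu≡Zw) Zu
    by-side : ∀ s → Z ! u ≡ s → ¬ LinIndep (principal G P) P
    by-side true  Zu = inside-singular P u (on-side Zu) P-u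
    by-side false Zu = outside-singular P u (on-side Zu) P-u

  G-mixed : ∀ {z j} → Z ! z ≡ true → Z ! j ≡ false → G z j ≡ column j ! z
  G-mixed {z} {j} Zz Zj = Bool-ext (mk⇔
    (λ Gzj → Equivalence.to exchange (subst (ColBasis A) P△Z≡B (Equivalence.to (nonsingular⇔basis P) (nonsingular Gzj))))
    (λ cz → ¬-not λ Gzj → LinIndep⇒¬LinDep {A = principal G P} {P}
      (Equivalence.from (nonsingular⇔basis P) (subst (ColBasis A) (sym P△Z≡B) (Equivalence.from exchange cz))) (singular Gzj)))
    where
    open Exchange Zz Zj
    open Pair G G-sym z≢j (G-loopless z) (G-loopless j)
    P△Z≡B : P △ Z ≡ B
    P△Z≡B = ≗⇒≡ λ i → trans (!-△ P Z i) (pointwise i)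
      where
      pointwise : ∀ i → P ! i xor Z ! i ≡ B ! i
      pointwise i with i ≟ z | i ≟ j
      ... | yes refl | _        = trans (cong₂ _xor_ P-u Zz) (sym B-z)
      ... | no  _    | yes refl = trans (cong₂ _xor_ P-w Zj) (sym B-j)
      ... | no  i≢z  | no  i≢j  = trans (cong (_xor Z ! i) (P-other i≢z i≢j)) (sym (B-other i≢z i≢j))

  H : Graph n
  H = G +ₗ ⊤

  H-entry : ∀ i j → H i j ≡ G i j xor δ i j
  H-entry i j = trans (cong (λ t → G i j xor (δ i j ∧ t)) (!-⊤ i)) (cong (G i j xor_) (∧-identityʳ (δ i j)))

  H-sym : Symmetric H
  H-sym i j = trans (H-entry i j) (trans (cong₂ _xor_ (G-sym i j) (δ-sym i j)) (sym (H-entry j i)))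

  ·-H : ∀ x i → (H · x) i ≡ (G · x) i xor x ! i
  ·-H x i = trans (·-+ₗ G ⊤ x i) (cong (λ t → (G · x) i xor (t ∧ x ! i)) (!-⊤ i))

  G-row : ∀ {z} → Z ! z ≡ true → ∀ j → G z j ≡ not (Z ! j) ∧ column j ! z
  G-row {z} Zz j = by-side (Z ! j) refl
    where
    by-side : ∀ s → Z ! j ≡ s → G z j ≡ not s ∧ column j ! z
    by-side true  Zj = G-same z j (trans Zz (sym Zj))
    by-side false Zj = G-mixed Zz Zj

  shear-on-Z : ∀ x {z} → Z ! z ≡ true → shear x ! z ≡ (H · x) z
  shear-on-Z x {z} Zz = begin
    shear x ! z                                           ≡⟨ !-△ x (lift (x ∩ ∁ Z)) z ⟩
    x ! z xor lift (x ∩ ∁ Z) ! z                          ≡⟨ cong (x ! z xor_) (!-tabulate _ z) ⟩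
    x ! z xor Σ₂ (λ j → (x ∩ ∁ Z) ! j ∧ column j ! z)     ≡⟨ cong (x ! z xor_) (Σ₂-cong entry) ⟩
    x ! z xor (G · x) z                                   ≡⟨ xor-comm (x ! z) _ ⟩
    (G · x) z xor x ! z                                   ≡⟨ ·-H x z ⟨
    (H · x) z                                            ∎
    where
    open ≡-Reasoning
    rearrange : ∀ a s c → (a ∧ s) ∧ c ≡ (s ∧ c) ∧ a
    rearrange = solve-∀ GF2
    entry : ∀ j → (x ∩ ∁ Z) ! j ∧ column j ! z ≡ G z j ∧ x ! j
    entry j = trans (cong (_∧ column j ! z) (!-∩∁ x Z j))
                    (trans (rearrange (x ! j) (not (Z ! j)) (column j ! z)) (cong (_∧ x ! j) (sym (G-row Zz j))))

  VanishesOn : (Fin n → Set) → Subset n → Set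
  VanishesOn P x = ∀ i → P i → (H · x) i ≡ false

  CS⇔Vanishes : ∀ X → CS M X ⇔ VanishesOn (λ i → Z ! i ≡ true) X
  CS⇔Vanishes X = mk⇔
    (λ cs z Zz → trans (sym (shear-on-Z X Zz)) (trans (sym (∧-identityʳ _)) (trans (cong (shear X ! z ∧_) (sym Zz))
                   (trans (sym (!-∩ (shear X) Z z)) (empty-of cs z)))))
    (λ vanish → Equivalence.from (CS⇔Ker X) (Equivalence.from (Ker⇔shear∩S≡∅ X) λ i →
       trans (!-∩ (shear X) Z i) (on-Z vanish i (Z ! i) refl)))
    where
    empty-of : CS M X → ∀ i → (shear X ∩ Z) ! i ≡ false
    empty-of cs = Equivalence.to (Ker⇔shear∩S≡∅ X) (Equivalence.to (CS⇔Ker X) cs)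
    on-Z : VanishesOn (λ i → Z ! i ≡ true) X → ∀ i s → Z ! i ≡ s → shear X ! i ∧ s ≡ false
    on-Z vanish i false _  = ∧-zeroʳ _
    on-Z vanish i true  Zi = trans (∧-identityʳ _) (trans (shear-on-Z X Zi) (vanish i Zi))

  fundamental-row : ∀ {j} → Z ! j ≡ false → ∀ i → fundamental j ! i ≡ H j i
  fundamental-row {j} Zj i = begin
    fundamental j ! i                ≡⟨ !-△ (column j) ⁅ j ⁆ i ⟩
    column j ! i xor ⁅ j ⁆ ! i       ≡⟨ cong₂ _xor_ (sym (trans (G-sym j i) (by-side (Z ! i) refl))) (trans (!-⁅⁆ j i) (δ-sym i j)) ⟩
    G j i xor δ j i                  ≡⟨ H-entry j i ⟨
    H j i                           ∎
    where
    open ≡-Reasoning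
    by-side : ∀ s → Z ! i ≡ s → G i j ≡ column j ! i
    by-side true  Zi = G-mixed Zi Zj
    by-side false Zi = trans (G-same i j (trans Zi (sym Zj))) (sym (column∌ j Zi))

  fundamental-•-row : ∀ {j} → Z ! j ≡ false → ∀ X → fundamental j • X ≡ (H · X) j
  fundamental-•-row Zj X = Σ₂-cong λ i → cong (_∧ X ! i) (fundamental-row Zj i)

  CS⊥⇔Vanishes : ∀ X → (CS M ⊥ˢ) X ⇔ VanishesOn (λ i → Z ! i ≡ false) X
  CS⊥⇔Vanishes X = mk⇔
    (λ X⊥CS j Zj → trans (sym (fundamental-•-row Zj X))
                         (X⊥CS (fundamental j) (fundamental j ∷ [] , fundamental-circuit j Zj ∷ [] , △-identityʳ (fundamental j))))
    (λ vanish Y csY → begin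
      Y • X                                                           ≡⟨ cong (_• X) (Ker⇒decomposed Y (CS⇒Ker Y csY)) ⟩
      combination ((Y ∩ ∁ Z) !_) fundamental • X                      ≡⟨ •-combination ((Y ∩ ∁ Z) !_) fundamental X ⟩
      Σ₂ (λ j → (Y ∩ ∁ Z) ! j ∧ (fundamental j • X))                  ≡⟨ Σ₂-zero (λ j → term vanish Y j ((Y ∩ ∁ Z) ! j) refl) ⟩
      false                                                           ∎)
    where
    open ≡-Reasoning
    term : VanishesOn (λ i → Z ! i ≡ false) X → ∀ Y j c → (Y ∩ ∁ Z) ! j ≡ c → c ∧ (fundamental j • X) ≡ false
    term vanish Y j false _ = refl
    term vanish Y j true  e = trans (fundamental-•-row (∩∁-∋⇒∉ Y j e) X) (vanish j (∩∁-∋⇒∉ Y j e))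

  Ker⇔Vanishes : ∀ X → Ker H X ⇔ (VanishesOn (λ i → Z ! i ≡ true) X × VanishesOn (λ i → Z ! i ≡ false) X)
  Ker⇔Vanishes X = mk⇔ (λ HX≡0 → (λ i _ → HX≡0 i) , (λ i _ → HX≡0 i))
                       (λ (onZ , off) i → by-side i (Z ! i) refl onZ off)
    where
    by-side : ∀ i s → Z ! i ≡ s → VanishesOn (λ i → Z ! i ≡ true) X → VanishesOn (λ i → Z ! i ≡ false) X → (H · X) i ≡ false
    by-side i true  Zi onZ _   = onZ i Zi
    by-side i false Zi _   off = off i Zi

  -- Own cuts out CS M or its orthogonal complement, whichever is attached to the side of the bipartition containing v,
  -- and Other the remaining one; this is where P and Q trade places when v ∈ Z.
  module Side {v : Fin n} {s : Bool} (Zv : Z ! v ≡ s) where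

    Own Other : Subset n → Set
    Own   = VanishesOn (λ i → Z ! i ≡ s)
    Other = VanishesOn (λ i → Z ! i ≡ not s)

    H-own : ∀ {i} → Z ! i ≡ s → H i v ≡ δ i v
    H-own {i} Zi = trans (H-entry i v) (cong (_xor δ i v) (G-same i v (trans Zi (sym Zv))))

    δ-other : ∀ {i} → Z ! i ≡ not s → δ i v ≡ false
    δ-other {i} Zi = δ-≢ {i = i} {v} λ { refl → s≢not-s (trans (sym Zv) Zi) }
      where
      s≢not-s : ∀ {b} → b ≢ not b
      s≢not-s {false} ()
      s≢not-s {true}  ()

    Solves⇔ : ∀ x → Solves H v x ⇔ (Other x × Own (x △ ⁅ v ⁆))
    Solves⇔ x = mk⇔
      (λ hits → (λ i Zi → trans (hits i) (δ-other Zi)) ,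
                (λ i Zi → trans (·-△⁅v⁆ i) (≡⇒xor≡false (trans (hits i) (sym (H-own Zi))))))
      (λ (other , own) i → by-side i (Z ! i) refl other own)
      where
      ·-△⁅v⁆ : ∀ i → (H · (x △ ⁅ v ⁆)) i ≡ (H · x) i xor H i v
      ·-△⁅v⁆ i = trans (·-△ H x ⁅ v ⁆ i) (cong ((H · x) i xor_) (·-⁅⁆ H v i))
      by-side : ∀ i b → Z ! i ≡ b → Other x → Own (x △ ⁅ v ⁆) → (H · x) i ≡ δ i v
      by-side i b Zi other own with b ≟ᴮ s
      ... | yes refl = trans (xor-moveʳ (·-△⁅v⁆ i)) (cong₂ _xor_ (own i Zi) (H-own Zi))
      ... | no  b≢s  = trans (other i (trans Zi (¬-not b≢s))) (sym (δ-other (trans Zi (¬-not b≢s))))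

    module _ (OwnS OtherS : Subset n → Set) (OwnS⇔ : ∀ X → OwnS X ⇔ Own X) (OtherS⇔ : ∀ X → OtherS X ⇔ Other X) where

      P-translation : (∃[ X ] (OtherS X × v ∈ X × OwnS (X - v))) ⇔ Pᴴ H v
      P-translation = mk⇔
        (λ (X , other , v∈X , own) → X ,
          Equivalence.from (Solves⇔ X) (Equivalence.to (OtherS⇔ X) other ,
                                      subst Own (-≡△⁅⁆ X v ([]=⇒lookup v∈X)) (Equivalence.to (OwnS⇔ (X - v)) own)) ,
          []=⇒lookup v∈X)
        (λ (X , hits , Xv) → X , Equivalence.from (OtherS⇔ X) (proj₁ (Equivalence.to (Solves⇔ X) hits)) , lookup⇒[]= v X Xv ,
          Equivalence.from (OwnS⇔ (X - v)) (subst Own (sym (-≡△⁅⁆ X v Xv)) (proj₂ (Equivalence.to (Solves⇔ X) hits))))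

      Q-translation : (∃[ X ] (OwnS X × v ∈ X × OtherS (X - v))) ⇔ Qᴴ H v
      Q-translation = mk⇔
        (λ (X , own , v∈X , other) → X - v ,
          Equivalence.from (Solves⇔ (X - v)) (Equivalence.to (OtherS⇔ (X - v)) other ,
            subst Own (sym (trans (cong (_△ ⁅ v ⁆) (-≡△⁅⁆ X v ([]=⇒lookup v∈X))) (△-cancelʳ X ⁅ v ⁆))) (Equivalence.to (OwnS⇔ X) own)) ,
          -∉ X v)
        (λ (y , hits , yv) → y △ ⁅ v ⁆ ,
          Equivalence.from (OwnS⇔ (y △ ⁅ v ⁆)) (proj₂ (Equivalence.to (Solves⇔ y) hits)) ,
          lookup⇒[]= v (y △ ⁅ v ⁆) (trans (△⁅⁆-self y v) (cong not yv)) ,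
          Equivalence.from (OtherS⇔ ((y △ ⁅ v ⁆) - v))
            (subst Other (sym (trans (-≡△⁅⁆ (y △ ⁅ v ⁆) v (trans (△⁅⁆-self y v) (cong not yv))) (△-cancelʳ y ⁅ v ⁆)))
                   (proj₁ (Equivalence.to (Solves⇔ y) hits))))

  R-translation : ∀ v → inR M v ⇔ Rᴴ H v
  R-translation v = mk⇔
    (λ (X , cs , cs⊥ , v∈X) → X , Equivalence.from (Ker⇔Vanishes X) (Equivalence.to (CS⇔Vanishes X) cs , Equivalence.to (CS⊥⇔Vanishes X) cs⊥) ,
                              []=⇒lookup v∈X)
    (λ (X , HX≡0 , Xv) → X , Equivalence.from (CS⇔Vanishes X) (proj₁ (Equivalence.to (Ker⇔Vanishes X) HX≡0)) ,
                         Equivalence.from (CS⊥⇔Vanishes X) (proj₂ (Equivalence.to (Ker⇔Vanishes X) HX≡0)) , lookup⇒[]= v X Xv)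

corollary5 : ∀ {n} (M : SetSystem n) → IsBinaryMatroid M →
    (Z : Subset n) → M Z →
    (G : Graph n) → Symmetric G → (∀ X → graphMatroid G X ⇔ (M * Z) X) →
    (v : Fin n) →
      (v ∉ Z →
        (inP M v ⇔ nmax (G +ₗ ⊤) v ≡ ν ((G +ₗ ⊤) +ₗ ⁅ v ⁆))
        × (inQ M v ⇔ nmax (G +ₗ ⊤) v ≡ ν ((G +ₗ ⊤) ∖ᵥ v))
        × (inR M v ⇔ nmax (G +ₗ ⊤) v ≡ ν (G +ₗ ⊤)))
      × (v ∈ Z →
        (inQ M v ⇔ nmax (G +ₗ ⊤) v ≡ ν ((G +ₗ ⊤) +ₗ ⁅ v ⁆))
        × (inP M v ⇔ nmax (G +ₗ ⊤) v ≡ ν ((G +ₗ ⊤) ∖ᵥ v))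
        × (inR M v ⇔ nmax (G +ₗ ⊤) v ≡ ν (G +ₗ ⊤)))
corollary5 {zero}  M _ Z _ G _ _ ()
corollary5 {suc n} M (_ , A , M⇔A) Z MZ G G-sym G⇔ v =
  (λ v∉Z → let open Side (∉⇒≡false v∉Z) in
      ⇔-trans (P-translation (CS M ⊥ˢ) (CS M) CS⊥⇔Vanishes CS⇔Vanishes) P⇔ ,
      ⇔-trans (Q-translation (CS M ⊥ˢ) (CS M) CS⊥⇔Vanishes CS⇔Vanishes) Q⇔ ,
      ⇔-trans (R-translation v) R⇔) ,
  (λ v∈Z → let open Side ([]=⇒lookup v∈Z) in
      ⇔-trans (P-translation (CS M) (CS M ⊥ˢ) CS⇔Vanishes CS⊥⇔Vanishes) P⇔ ,
      ⇔-trans (Q-translation (CS M) (CS M ⊥ˢ) CS⇔Vanishes CS⊥⇔Vanishes) Q⇔ ,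
      ⇔-trans (R-translation v) R⇔)
  where
  open FundamentalGraph M A M⇔A Z MZ G G-sym G⇔
  open Nullities H-sym v using (nmax-characterisation)
  R⇔ : Rᴴ H v ⇔ nmax H v ≡ ν H
  R⇔ = proj₁ nmax-characterisation
  P⇔ : Pᴴ H v ⇔ nmax H v ≡ ν (H +ₗ ⁅ v ⁆)
  P⇔ = proj₁ (proj₂ nmax-characterisation)
  Q⇔ : Qᴴ H v ⇔ nmax H v ≡ ν (H ∖ᵥ v)
  Q⇔ = proj₂ (proj₂ nmax-characterisation)
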